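{- Let $B=(U,D)$ be a mixed adjacency matrix of size $r$ with $D\ne\mathbf 0$, $U_{ii}=0$ for all $i\in[r]$, and such that the mixed graph $B[\![\mathbf 1]\!]$ has complete underlying undirected graph (i.e. $U_{ij}+D_{ij}+D_{ji}>0$ for all $i\ne j$). Then there exists a finite family $\mathcal F$ of mixed graphs such that \[\theta(\mathcal F)=\min_{\mathbf y\in\Delta_r}\frac{1-\mathbf y^\intercal U\mathbf y}{\mathbf y^\intercal D\mathbf y},\] where the quotient is $\infty$ when $\mathbf y^\intercal D\mathbf y=0$.
   Context: Mixed graphs: finite vertex set, at most one edge on each pair of distinct vertices, each edge undirected or directed (tail $\to$ head). $\alpha(G),\beta(G)$ are the numbers of undirected and directed edges divided by $\binom{v(G)}2$. $F\subseteq G$ means there is an injection $\phi:V(F)\to V(G)$ sending undirected edges of $F$ to pairs joined by an edge of either type and each directed edge $u\to v$ of $F$ to the directed edge $\phi(u)\to\phi(v)$ of $G$. For a finite family $\mathcal F$, $G$ is $\mathcal F$-free if no member of $\mathcal F$ is a subgraph of $G$; $\theta(\mathcal F)$ is the maximum $\rho$ with $\limsup_n\max\{\alpha(G)+\rho\beta(G):G\ \mathcal F\text{ -free},\ v(G)=n\}\le1$ ($\theta(\mathcal F)=\infty$ if $\max\beta(G)\to0$). A mixed adjacency matrix of size $r$ is a pair $(U,D)$ of $r\times r$ matrices with $U$ symmetric 0/1, $D_{ij}\in\{0,2\}$, $D_{ij}\ne0\Rightarrow D_{ji}=0$, and at most one of $U_{ij},D_{ij}$ nonzero for all $i,j$.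 For $\mathbf x\in\mathbb Z^r_{\ge0}$, $B[\![\mathbf x]\!]$ has vertex set $W_1\sqcup\dots\sqcup W_r$ with $|W_i|=x_i$; $W_i$ is an undirected clique if $U_{ii}=1$ and independent otherwise; for $i\ne j$ all pairs between $W_i,W_j$ are undirected edges if $U_{ij}=1$, directed edges from $W_i$ to $W_j$ if $D_{ij}=2$, and non-edges otherwise. $\mathbf 1$ is the all-ones vector, $\Delta_r=\{\mathbf y\in\mathbb R_{\ge0}^r:\|\mathbf y\|_1=1\}$.
   Formalization: The parameter ρ in the definition of θ(𝓕) and the points $\mathbf y$ of $\Delta_r$ over which the minimum is taken range over the rationals rather than the reals. -}

module Defs where

open import Data.Nat as ℕ using (ℕ; zero; suc)
open import Data.Bool using (Bool; true; false; T; _∨_)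
open import Data.Fin using (Fin; zero; suc)
open import Data.Integer using (+_)
open import Data.Rational using (ℚ; 0ℚ; 1ℚ; _+_; _*_; _-_; _≤_; _<_; _/_)
open import Data.Product using (Σ; ∃; _×_; _,_; proj₂)
open import Data.List using (List)
open import Data.List.Relation.Unary.All using (All)
open import Relation.Binary.PropositionalEquality using (_≡_; _≢_)
open import Relation.Nullary using (¬_)
open import Function.Definitions using (Injective)

-- Mixed graphs on vertex set Fin n.
-- Und i j = true : undirected edge {i,j};  Dir i j = true : directed edge i → j.
record MixedGraph (n : ℕ) : Set where
  field
    Und      : Fin n → Fin n → Bool
    Dir      : Fin n → Fin n → Bool
    und-irr  : ∀ i → Und i i ≡ false
    und-sym  : ∀ i j → Und i j ≡ Und j i
    dir-irr  : ∀ i → Dir i i ≡ false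
    dir-asym : ∀ i j → Dir i j ≡ true → Dir j i ≡ false
    disjoint : ∀ i j → Und i j ≡ true → Dir i j ≡ false
open MixedGraph public

Graph : Set
Graph = Σ ℕ MixedGraph

record _⊆_ {m n : ℕ} (F : MixedGraph m) (G : MixedGraph n) : Set where
  field
    φ      : Fin m → Fin n
    φ-inj  : Injective _≡_ _≡_ φ
    φ-und  : ∀ u v → T (Und F u v) →
             T (Und G (φ u) (φ v) ∨ Dir G (φ u) (φ v) ∨ Dir G (φ v) (φ u))
    φ-dir  : ∀ u v → T (Dir F u v) → T (Dir G (φ u) (φ v))

Free : List Graph → ∀ {n} → MixedGraph n → Set
Free 𝓕 G = All (λ F → ¬ (proj₂ F ⊆ G)) 𝓕

countFin : ∀ {n} → (Fin n → Bool) → ℕ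
countFin {zero}  f = 0
countFin {suc n} f with f zero
... | true  = suc (countFin (λ i → f (suc i)))
... | false = countFin (λ i → f (suc i))

sumℕ : ∀ {n} → (Fin n → ℕ) → ℕ
sumℕ {zero}  f = 0
sumℕ {suc n} f = f zero ℕ.+ sumℕ (λ i → f (suc i))

countPairs : ∀ {n} → (Fin n → Fin n → Bool) → ℕ
countPairs p = sumℕ (λ i → countFin (p i))

-- α(G) = #undirected edges / C(n,2) = #(ordered pairs with Und) / (n(n-1));
-- β(G) = #directed edges / C(n,2)   = 2·#(ordered pairs with Dir) / (n(n-1)).
-- (For n < 2 the binomial is 0; we set α = β = 0 there; irrelevant for limsup.)
α : ∀ {n} → MixedGraph n → ℚ
α {zero}        G = 0ℚ
α {suc zero}    G = 0ℚ
α {suc (suc k)} G = (+ countPairs (Und G)) / (suc (suc k) ℕ.* suc k)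

β : ∀ {n} → MixedGraph n → ℚ
β {zero}        G = 0ℚ
β {suc zero}    G = 0ℚ
β {suc (suc k)} G = (+ (2 ℕ.* countPairs (Dir G))) / (suc (suc k) ℕ.* suc k)

-- limsup_n max{ α(G) + ρ β(G) : G 𝓕-free, v(G) = n } ≤ 1, written out with ε:
LimsupBound : List Graph → ℚ → Set
LimsupBound 𝓕 ρ =
  ∀ (ε : ℚ) → 0ℚ < ε → ∃ λ (N : ℕ) → ∀ (n : ℕ) → N ℕ.≤ n →
    ∀ (G : MixedGraph n) → Free 𝓕 G → α G + ρ * β G ≤ 1ℚ + ε

-- Mixed adjacency matrices of size r.
-- U i j = true : U_ij = 1;  D i j = true : D_ij = 2.
record MixedAdjMatrix (r : ℕ) : Set where
  field
    U        : Fin r → Fin r → Bool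
    D        : Fin r → Fin r → Bool
    U-sym    : ∀ i j → U i j ≡ U j i
    D-asym   : ∀ i j → D i j ≡ true → D j i ≡ false
    disjoint : ∀ i j → U i j ≡ true → D i j ≡ false
open MixedAdjMatrix public

sumℚ : ∀ {r} → (Fin r → ℚ) → ℚ
sumℚ {zero}  f = 0ℚ
sumℚ {suc r} f = f zero + sumℚ (λ i → f (suc i))

U-entry : ∀ {r} → MixedAdjMatrix r → Fin r → Fin r → ℚ
U-entry B i j with U B i j
... | true  = 1ℚ
... | false = 0ℚ

D-entry : ∀ {r} → MixedAdjMatrix r → Fin r → Fin r → ℚ
D-entry B i j with D B i j
... | true  = 1ℚ + 1ℚ
... | false = 0ℚ

quad : ∀ {r} → (Fin r → Fin r → ℚ) → (Fin r → ℚ) → ℚ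
quad M y = sumℚ (λ i → sumℚ (λ j → y i * M i j * y j))

InSimplex : ∀ {r} → (Fin r → ℚ) → Set
InSimplex y = (∀ i → 0ℚ ≤ y i) × sumℚ y ≡ 1ℚ

{-# OPTIONS --safe #-}
module Submission where

-- Let K = U + ρD.  By homogeneity, the condition ρ yᵀDy ≤ 1 - yᵀUy on the simplex says that
-- yᵀKy ≤ (Σy)² for all y ≥ 0: the Lagrangian of K is at most 1.  Take 𝓕 to be the complete mixed
-- graphs on at most r + 1 vertices that are not subgraphs of B⟦𝟏⟧.
--
-- Upper bound: by induction on v(G), every 𝓕-free G has Lagrangian at most 1 for its own K_G.  If G
-- is complete, it is a subgraph of B⟦𝟏⟧ (it has at most r vertices, by pigeonhole), and for complete
-- graphs the bound reads (ρ - 1) yᵀDy ≤ yᵀy, which transfers from B⟦𝟏⟧ to G along the embedding.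
-- Otherwise take a non-adjacent pair u, v: yᵀK_G y is affine in the weight moved between u and v, so
-- one of them can be emptied without decreasing it, and then deleted.  Taking y = 𝟙 gives
-- α(G) + ρβ(G) ≤ n/(n - 1).
--
-- Lower bound: blow-ups B⟦x⟧ are 𝓕-free, because a complete graph meets each (independent) part of
-- a blow-up at most once.  For rational y in the simplex and x a large integer multiple of y, the
-- density α + ρβ of B⟦x⟧ is at least yᵀKy.

open import Defs
open import Algebra.Bundles using (CommutativeRing; Semiring)
open import Data.Bool using (Bool; true; false; T; not; _∧_; _∨_)
open import Data.Bool.Properties using (T-∨; ∨-comm; ∨-inverseˡ; ∧-inverseʳ)
open import Data.Empty using (⊥-elim)
open import Data.Fin using (Fin; zero; suc; punchIn; splitAt; _↑ˡ_; _↑ʳ_; inject≤)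
import Data.Fin.Properties as Finₚ
import Data.Integer as ℤ
import Data.Integer.Properties as ℤₚ
open import Data.List using (List; []; _∷_; _++_; map; filter; cartesianProductWith; allFin)
open import Data.List.Membership.Propositional using (_∈_; lose)
open import Data.List.Membership.Propositional.Properties
  using (∈-cartesianProductWith⁺; ∈-++⁺ˡ; ∈-++⁺ʳ; ∈-map⁺; ∈-filter⁺; ∈-filter⁻; ∈-allFin)
import Data.List.Relation.Unary.All as All
import Data.List.Relation.Unary.All.Properties as Allₚ
open import Data.List.Relation.Unary.Any using (here; there; any?; satisfied)
open import Data.Nat as ℕ using (ℕ; zero; suc)
import Data.Nat.Properties as ℕₚ
open import Data.Product using (∃; ∃₂; _×_; _,_; proj₁; proj₂)
open import Data.Rational as ℚ
  using (ℚ; 0ℚ; 1ℚ; _+_; _*_; _-_; -_; _≤_; _<_; _/_; 1/_; ↧ₙ_; mkℚ; toℚᵘ; NonZero; Positive; positive; nonNegative; nonPositive)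
open import Data.Rational.Properties
import Data.Rational.Unnormalised as ℚᵘ
import Data.Rational.Unnormalised.Properties as ℚᵘₚ
open import Data.Rational.Solver using (module +-*-Solver)
open import Data.Sum as Sum using (_⊎_; inj₁; inj₂; [_,_]′)
open import Data.Unit using (tt)
import Data.Vec as Vec
open Vec using (Vec; lookup; tabulate)
open import Data.Vec.Properties using (lookup∘tabulate)
open import Function as Function using (_∘_; const; case_of_; Equivalence; _⇔_; mk⇔)
open import Function.Definitions using (Injective)
open import Level using (0ℓ)
open import Relation.Binary.Definitions using (tri<; tri≈; tri>)
open import Relation.Binary.PropositionalEquality
open import Relation.Nullary using (¬_; Dec; yes; no; does; ¬?)
open import Relation.Nullary.Decidable using (dec-true; dec-false; decidable-stable; _×-dec_; _→-dec_; T?)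

open +-*-Solver

ℚ-semiring : Semiring 0ℓ 0ℓ
ℚ-semiring = CommutativeRing.semiring +-*-commutativeRing

open import Algebra.Properties.Semiring.Sum ℚ-semiring
  using (sum; sum-cong-≗; ∑-distrib-+; ∑-comm; *-distribˡ-sum; *-distribʳ-sum; sum-remove; sum-replicate; sum-replicate-zero)
open import Algebra.Properties.Semiring.Mult ℚ-semiring
  using (×-homo-+; ×1-homo-*; ×-assoc-*) renaming (_×_ to _·_)

private
  variable
    m n r : ℕ
    p q : ℚ

NonNeg : (Fin n → ℚ) → Set
NonNeg y = ∀ i → 0ℚ ≤ y i

*-nonNeg : 0ℚ ≤ p → 0ℚ ≤ q → 0ℚ ≤ p * q
*-nonNeg {p} {q} 0≤p 0≤q =
  nonNegative⁻¹ (p * q) {{nonNeg*nonNeg⇒nonNeg p {{nonNegative 0≤p}} q {{nonNegative 0≤q}}}}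

*-nonPos-nonNeg : p ≤ 0ℚ → 0ℚ ≤ q → p * q ≤ 0ℚ
*-nonPos-nonNeg {p} {q} p≤0 0≤q =
  nonPositive⁻¹ (p * q) {{nonPos*nonNeg⇒nonPos p {{nonPositive p≤0}} q {{nonNegative 0≤q}}}}

*-monoˡ-≤-nonNeg′ : 0ℚ ≤ p → ∀ {a b} → a ≤ b → p * a ≤ p * b
*-monoˡ-≤-nonNeg′ {p} 0≤p = *-monoˡ-≤-nonNeg p {{nonNegative 0≤p}}

≤-rearrange : (s : ℚ) {p q p′ q′ : ℚ} → p + s ≡ p′ → q + s ≡ q′ → p ≤ q → p′ ≤ q′
≤-rearrange s refl refl p≤q = +-monoˡ-≤ s p≤q

weighted≤⇔ : (u d i ρ : ℚ) → (u + ρ * d ≤ i + (u + d)) ⇔ ((ρ - 1ℚ) * d ≤ i)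
weighted≤⇔ u d i ρ = mk⇔
  (≤-rearrange (- (u + d)) (solve 3 (λ u d ρ → u :+ ρ :* d :+ (:- (u :+ d)) := (ρ :- con 1ℚ) :* d) refl u d ρ)
                           (solve 3 (λ i u d → i :+ (u :+ d) :+ (:- (u :+ d)) := i) refl i u d))
  (≤-rearrange (u + d) (solve 3 (λ u d ρ → (ρ :- con 1ℚ) :* d :+ (u :+ d) := u :+ ρ :* d) refl u d ρ) refl)

≤-sub⇔+≤ : (p q r : ℚ) → (p ≤ r - q) ⇔ (q + p ≤ r)
≤-sub⇔+≤ p q r = mk⇔ (≤-rearrange q (+-comm p q) (solve 2 (λ r q → r :- q :+ q := r) refl r q))
                     (≤-rearrange (- q) (solve 2 (λ q p → q :+ p :+ (:- q) := p) refl q p) refl)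

≤+ε⇒≤ : (∀ ε → 0ℚ < ε → p ≤ q + ε) → p ≤ q
≤+ε⇒≤ {p} {q} ≤q+ε with p ≤? q
... | yes p≤q = p≤q
... | no p≰q  with <-dense (≰⇒> p≰q)
...   | m , q<m , m<p = ⊥-elim (<-irrefl refl (≤-<-trans p≤m m<p))
  where
  0<m-q : 0ℚ < m - q
  0<m-q = subst (_< m - q) (+-inverseʳ q) (+-monoˡ-< (- q) q<m)
  p≤m : p ≤ m
  p≤m = subst (p ≤_) (solve 2 (λ q m → q :+ (m :- q) := m) refl q m) (≤q+ε (m - q) 0<m-q)

fromℕ : ℕ → ℚ
fromℕ n = n · 1ℚ

fromℕ-+ : (a b : ℕ) → fromℕ (a ℕ.+ b) ≡ fromℕ a + fromℕ b
fromℕ-+ a b = ×-homo-+ 1ℚ a b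

fromℕ-* : (a b : ℕ) → fromℕ (a ℕ.* b) ≡ fromℕ a * fromℕ b
fromℕ-* = ×1-homo-*

fromℕ-nonNeg : (a : ℕ) → 0ℚ ≤ fromℕ a
fromℕ-nonNeg zero    = ≤-refl
fromℕ-nonNeg (suc a) = +-mono-≤ (nonNegative⁻¹ 1ℚ) (fromℕ-nonNeg a)

fromℕ-mono-≤ : {a b : ℕ} → a ℕ.≤ b → fromℕ a ≤ fromℕ b
fromℕ-mono-≤ {b = b} ℕ.z≤n   = fromℕ-nonNeg b
fromℕ-mono-≤ (ℕ.s≤s a≤b) = +-monoʳ-≤ 1ℚ (fromℕ-mono-≤ a≤b)

fromℕ-<-suc : (a : ℕ) → fromℕ a < fromℕ (suc a)
fromℕ-<-suc a = subst (_< 1ℚ + fromℕ a) (+-identityˡ (fromℕ a)) (+-monoˡ-< (fromℕ a) (positive⁻¹ 1ℚ))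

fromℕ-suc-pos : (a : ℕ) → 0ℚ < fromℕ (suc a)
fromℕ-suc-pos a = ≤-<-trans (fromℕ-nonNeg a) (fromℕ-<-suc a)

fromℕ-cancel-≤ : {a b : ℕ} → fromℕ a ≤ fromℕ b → a ℕ.≤ b
fromℕ-cancel-≤ {a} {b} fa≤fb with a ℕₚ.≤? b
... | yes a≤b = a≤b
... | no a≰b  = ⊥-elim (<-irrefl refl (≤-<-trans fa≤fb (<-≤-trans (fromℕ-<-suc b) (fromℕ-mono-≤ (ℕₚ.≰⇒> a≰b)))))

fromℕ-toℚᵘ : (n : ℕ) → toℚᵘ (fromℕ n) ℚᵘ.≃ ℚᵘ.mkℚᵘ (ℤ.+ n) 0
fromℕ-toℚᵘ zero    = ℚᵘₚ.≃-refl
fromℕ-toℚᵘ (suc n) = ℚᵘₚ.≃-trans (toℚᵘ-homo-+ 1ℚ (fromℕ n))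
                       (ℚᵘₚ.≃-trans (ℚᵘₚ.+-cong (ℚᵘₚ.≃-refl {toℚᵘ 1ℚ}) (fromℕ-toℚᵘ n)) (ℚᵘ.*≡* cross))
  where
  cross : (ℤ.+ 1 ℤ.+ ℤ.+ n ℤ.* ℤ.+ 1) ℤ.* ℤ.+ 1 ≡ ℤ.+ suc n ℤ.* ℤ.+ 1
  cross = cong (λ z → (ℤ.+ 1 ℤ.+ z) ℤ.* ℤ.+ 1) (ℤₚ.*-identityʳ (ℤ.+ n))

/-fromℕ : (a m : ℕ) → (ℤ.+ a / suc m) * fromℕ (suc m) ≡ fromℕ a
/-fromℕ a m = toℚᵘ-injective
  (ℚᵘₚ.≃-trans (toℚᵘ-homo-* (ℤ.+ a / suc m) (fromℕ (suc m)))
  (ℚᵘₚ.≃-trans (ℚᵘₚ.*-cong (toℚᵘ-fromℚᵘ (ℚᵘ.mkℚᵘ (ℤ.+ a) m)) (fromℕ-toℚᵘ (suc m)))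
  (ℚᵘₚ.≃-trans (ℚᵘ.*≡* cross) (ℚᵘₚ.≃-sym (fromℕ-toℚᵘ a)))))
  where
  cross : (ℤ.+ a ℤ.* ℤ.+ suc m) ℤ.* ℤ.+ 1 ≡ ℤ.+ a ℤ.* (ℤ.+ suc m ℤ.* ℤ.+ 1)
  cross = ℤₚ.*-assoc (ℤ.+ a) (ℤ.+ suc m) (ℤ.+ 1)

nonNeg-numerator : (p : ℚ) → 0ℚ ≤ p → ∃ λ a → p * fromℕ (↧ₙ p) ≡ fromℕ a
nonNeg-numerator p@(mkℚ (ℤ.+ a) d _) _ = a , trans (cong (_* fromℕ (suc d)) (sym (↥p/↧p≡p p))) (/-fromℕ a d)
nonNeg-numerator (mkℚ ℤ.-[1+ _ ] _ _) 0≤p = ⊥-elim (ℤ.NonNegative.nonNeg (nonNegative 0≤p))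

archimedean : (ε : ℚ) → 0ℚ < ε → ∃ λ M → 1ℚ ≤ ε * fromℕ M
archimedean ε 0<ε with nonNeg-numerator ε (<⇒≤ 0<ε)
... | zero  , ε*d≡0 = ⊥-elim (<-irrefl (sym ε*d≡0) 0<ε*d)
  where
  0<ε*d : 0ℚ < ε * fromℕ (↧ₙ ε)
  0<ε*d = subst (_< ε * fromℕ (↧ₙ ε)) (*-zeroˡ (fromℕ (↧ₙ ε)))
                (*-monoˡ-<-pos (fromℕ (↧ₙ ε)) {{positive (fromℕ-suc-pos (ℚ.denominator-1 ε))}} 0<ε)
... | suc a , ε*d≡1+a = ↧ₙ ε , subst (1ℚ ≤_) (sym ε*d≡1+a) (fromℕ-mono-≤ (ℕ.s≤s (ℕ.z≤n {a})))

common-denominator : (y : Fin r → ℚ) → NonNeg y → ∃₂ λ L (a : Fin r → ℕ) → ∀ j → y j * fromℕ (suc L) ≡ fromℕ (a j)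
common-denominator {zero}  y 0≤y = 0 , (λ ()) , (λ ())
common-denominator {suc r} y 0≤y with nonNeg-numerator (y zero) (0≤y zero) | common-denominator (λ j → y (suc j)) (λ j → 0≤y (suc j))
... | a₀ , y₀d≡a₀ | L , a , yL≡a = L ℕ.+ d ℕ.* suc L , a′ , scaled   -- suc (L + d * suc L) = suc d * suc L
  where
  d : ℕ
  d = ℚ.denominator-1 (y zero)
  a′ : Fin (suc r) → ℕ
  a′ zero    = a₀ ℕ.* suc L
  a′ (suc j) = a j ℕ.* suc d
  scaled : ∀ j → y j * fromℕ (suc d ℕ.* suc L) ≡ fromℕ (a′ j)
  scaled zero    = begin
    y zero * fromℕ (suc d ℕ.* suc L)               ≡⟨ cong (y zero *_) (fromℕ-* (suc d) (suc L)) ⟩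
    y zero * (fromℕ (suc d) * fromℕ (suc L))       ≡⟨ sym (*-assoc (y zero) _ _) ⟩
    y zero * fromℕ (suc d) * fromℕ (suc L)         ≡⟨ cong (_* fromℕ (suc L)) y₀d≡a₀ ⟩
    fromℕ a₀ * fromℕ (suc L)                       ≡⟨ sym (fromℕ-* a₀ (suc L)) ⟩
    fromℕ (a₀ ℕ.* suc L)                           ∎
    where open ≡-Reasoning
  scaled (suc j) = begin
    y (suc j) * fromℕ (suc d ℕ.* suc L)            ≡⟨ cong (y (suc j) *_) (fromℕ-* (suc d) (suc L)) ⟩
    y (suc j) * (fromℕ (suc d) * fromℕ (suc L))    ≡⟨ solve 3 (λ y d l → y :* (d :* l) := y :* l :* d) refl (y (suc j)) _ _ ⟩
    y (suc j) * fromℕ (suc L) * fromℕ (suc d)      ≡⟨ cong (_* fromℕ (suc d)) (yL≡a j) ⟩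
    fromℕ (a j) * fromℕ (suc d)                    ≡⟨ sym (fromℕ-* (a j) (suc d)) ⟩
    fromℕ (a j ℕ.* suc d)                          ∎
    where open ≡-Reasoning

fromBool : Bool → ℚ
fromBool true  = 1ℚ
fromBool false = 0ℚ

fromBool-nonNeg : ∀ b → 0ℚ ≤ fromBool b
fromBool-nonNeg true  = nonNegative⁻¹ 1ℚ
fromBool-nonNeg false = ≤-refl

fromBool-mono : ∀ {a b} → (T a → T b) → fromBool a ≤ fromBool b
fromBool-mono {false} {b}     _   = fromBool-nonNeg b
fromBool-mono {true}  {true}  _   = ≤-refl
fromBool-mono {true}  {false} a⇒b = ⊥-elim (a⇒b tt)

¬T⇒≡false : ∀ {b} → ¬ T b → b ≡ false
¬T⇒≡false {false} _  = refl
¬T⇒≡false {true}  ¬t = ⊥-elim (¬t tt)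

one-of-three : ∀ a b c → T (a ∨ b ∨ c) → (a ≡ true → b ≡ false) → (a ≡ true → c ≡ false) → (b ≡ true → c ≡ false) →
               fromBool a + (fromBool b + fromBool c) ≡ 1ℚ
one-of-three true  false false _  _  _  _  = refl
one-of-three false true  false _  _  _  _  = refl
one-of-three false false true  _  _  _  _  = refl
one-of-three true  true  _     _  ab _  _  = case ab refl of λ ()
one-of-three true  false true  _  _  ac _  = case ac refl of λ ()
one-of-three false true  true  _  _  _  bc = case bc refl of λ ()
one-of-three false false false () _  _  _

not-∨-of-one-of-three : ∀ u a b → T (u ∨ a ∨ b) → (u ≡ true → a ≡ false) → (u ≡ true → b ≡ false) → not (a ∨ b) ≡ u
not-∨-of-one-of-three true  false false _  _  _  = refl
not-∨-of-one-of-three true  true  _     _  ua _  = case ua refl of λ ()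
not-∨-of-one-of-three true  false true  _  _  ub = case ub refl of λ ()
not-∨-of-one-of-three false true  _     _  _  _  = refl
not-∨-of-one-of-three false false true  _  _  _  = refl
not-∨-of-one-of-three false false false () _  _

∧-not-asym : ∀ a b → a ∧ not b ≡ true → b ∧ not a ≡ false
∧-not-asym true  false _ = refl
∧-not-asym false _     ()
∧-not-asym true  true  ()

∧-not-∨ : ∀ a x y → a ∧ not (x ∨ y) ≡ true → x ≡ false
∧-not-∨ true  false _ _ = refl
∧-not-∨ false _     _ ()
∧-not-∨ true  true  _ ()

∧-not-of-asym : ∀ a b → (a ≡ true → b ≡ false) → a ∧ not b ≡ a
∧-not-of-asym false _     _  = refl
∧-not-of-asym true  false _  = refl
∧-not-of-asym true  true  ab = case ab refl of λ ()

does-sym : (i j : Fin n) → does (i Finₚ.≟ j) ≡ does (j Finₚ.≟ i)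
does-sym i j with i Finₚ.≟ j | j Finₚ.≟ i
... | yes _   | yes _   = refl
... | no _    | no _    = refl
... | yes i≡j | no j≢i  = ⊥-elim (j≢i (sym i≡j))
... | no i≢j  | yes j≡i = ⊥-elim (i≢j (sym j≡i))

sumℚ≡sum : (f : Fin n → ℚ) → sumℚ f ≡ sum f
sumℚ≡sum {zero}  f = refl
sumℚ≡sum {suc n} f = cong (f zero +_) (sumℚ≡sum (λ i → f (suc i)))

sum-mono-≤ : {f g : Fin n → ℚ} → (∀ i → f i ≤ g i) → sum f ≤ sum g
sum-mono-≤ {zero}  f≤g = ≤-refl
sum-mono-≤ {suc n} f≤g = +-mono-≤ (f≤g zero) (sum-mono-≤ (λ i → f≤g (suc i)))

sum-nonNeg : {f : Fin n → ℚ} → (∀ i → 0ℚ ≤ f i) → 0ℚ ≤ sum f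
sum-nonNeg {n} {f} 0≤f = subst (_≤ sum f) (sum-replicate-zero n) (sum-mono-≤ 0≤f)

sum-zero : {f : Fin n → ℚ} → (∀ i → f i ≡ 0ℚ) → sum f ≡ 0ℚ
sum-zero {n} f≡0 = trans (sum-cong-≗ f≡0) (sum-replicate-zero n)

sum-nonNeg-≡0 : {y : Fin n → ℚ} → NonNeg y → sum y ≡ 0ℚ → ∀ i → y i ≡ 0ℚ
sum-nonNeg-≡0 {suc n} {y} 0≤y Σy≡0 = at
  where
  rest : ℚ
  rest = sum (λ i → y (suc i))
  rest-nonNeg : 0ℚ ≤ rest
  rest-nonNeg = sum-nonNeg (λ i → 0≤y (suc i))
  y₀≤Σy : y zero ≤ sum y
  y₀≤Σy = subst (_≤ y zero + rest) (+-identityʳ (y zero)) (+-monoʳ-≤ (y zero) rest-nonNeg)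
  y₀≡0 : y zero ≡ 0ℚ
  y₀≡0 = ≤-antisym (≤-trans y₀≤Σy (≤-reflexive Σy≡0)) (0≤y zero)
  at : ∀ i → y i ≡ 0ℚ
  at zero    = y₀≡0
  at (suc i) = sum-nonNeg-≡0 (λ i → 0≤y (suc i)) (trans (sym (+-identityˡ rest)) (trans (cong (_+ rest) (sym y₀≡0)) Σy≡0)) i

sum-remove-zero : (f : Fin (suc n) → ℚ) (x : Fin (suc n)) → f x ≡ 0ℚ → sum f ≡ sum (f ∘ punchIn x)
sum-remove-zero f x fx≡0 = trans (sum-remove {i = x} f) (trans (cong (_+ sum (f ∘ punchIn x)) fx≡0) (+-identityˡ _))

sum-↑ : {k : ℕ} (f : Fin (m ℕ.+ k) → ℚ) → sum f ≡ sum (λ i → f (i ↑ˡ k)) + sum (λ j → f (m ↑ʳ j))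
sum-↑ {zero}  f = sym (+-identityˡ (sum f))
sum-↑ {suc m} {k} f = trans (cong (f zero +_) (sum-↑ {m} {k} (λ i → f (suc i))))
                            (sym (+-assoc (f zero) (sum (λ i → f (suc (i ↑ˡ k)))) (sum (λ j → f (suc m ↑ʳ j)))))

sum² : (Fin m → Fin n → ℚ) → ℚ
sum² f = sum (λ i → sum (λ j → f i j))

sum²-cong : {f g : Fin m → Fin n → ℚ} → (∀ i j → f i j ≡ g i j) → sum² f ≡ sum² g
sum²-cong f≡g = sum-cong-≗ (λ i → sum-cong-≗ (f≡g i))

sum²-distrib-+ : (f g : Fin m → Fin n → ℚ) → sum² (λ i j → f i j + g i j) ≡ sum² f + sum² g
sum²-distrib-+ f g = trans (sum-cong-≗ (λ i → ∑-distrib-+ (f i) (g i))) (∑-distrib-+ (λ i → sum (f i)) (λ i → sum (g i)))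

sum²-*ˡ : (c : ℚ) (f : Fin m → Fin n → ℚ) → sum² (λ i j → c * f i j) ≡ c * sum² f
sum²-*ˡ c f = sym (trans (*-distribˡ-sum c (λ i → sum (f i))) (sum-cong-≗ (λ i → *-distribˡ-sum c (f i))))

sum²-mono-≤ : {f g : Fin m → Fin n → ℚ} → (∀ i j → f i j ≤ g i j) → sum² f ≤ sum² g
sum²-mono-≤ f≤g = sum-mono-≤ (λ i → sum-mono-≤ (f≤g i))

fromℕ-sumℕ : (x : Fin n → ℕ) → fromℕ (sumℕ x) ≡ sum (λ i → fromℕ (x i))
fromℕ-sumℕ {zero}  x = refl
fromℕ-sumℕ {suc n} x = trans (fromℕ-+ (x zero) _) (cong (fromℕ (x zero) +_) (fromℕ-sumℕ (λ i → x (suc i))))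

fromℕ-countFin : (p : Fin n → Bool) → fromℕ (countFin p) ≡ sum (λ i → fromBool (p i))
fromℕ-countFin {zero}  p = refl
fromℕ-countFin {suc n} p with p zero
... | true  = cong (1ℚ +_) (fromℕ-countFin (λ i → p (suc i)))
... | false = trans (fromℕ-countFin (λ i → p (suc i))) (sym (+-identityˡ _))

fromℕ-countPairs : (p : Fin n → Fin n → Bool) → fromℕ (countPairs p) ≡ sum² (λ i j → fromBool (p i j))
fromℕ-countPairs p = trans (fromℕ-sumℕ (λ i → countFin (p i))) (sum-cong-≗ (λ i → fromℕ-countFin (p i)))

δ : Fin n → Fin n → ℚ
δ i j = fromBool (does (i Finₚ.≟ j))

δ-refl : (i : Fin n) → δ i i ≡ 1ℚ
δ-refl i = cong fromBool (dec-true (i Finₚ.≟ i) refl)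

δ-≢ : {i j : Fin n} → i ≢ j → δ i j ≡ 0ℚ
δ-≢ {i = i} {j} i≢j = cong fromBool (dec-false (i Finₚ.≟ j) i≢j)

δ-nonNeg : (i j : Fin n) → 0ℚ ≤ δ i j
δ-nonNeg i j = fromBool-nonNeg (does (i Finₚ.≟ j))

δ-injective : {φ : Fin m → Fin n} → Injective _≡_ _≡_ φ → (i j : Fin m) → δ (φ i) (φ j) ≡ δ i j
δ-injective {φ = φ} φ-inj i j with i Finₚ.≟ j
... | yes refl = δ-refl (φ i)
... | no i≢j   = δ-≢ (i≢j ∘ φ-inj)

sum-δ : (x : Fin n) (f : Fin n → ℚ) → sum (λ j → δ x j * f j) ≡ f x
sum-δ {suc n} x f = begin
  sum (λ j → δ x j * f j)                                          ≡⟨ sum-remove {i = x} (λ j → δ x j * f j) ⟩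
  δ x x * f x + sum (λ j → δ x (punchIn x j) * f (punchIn x j))  ≡⟨ cong₂ _+_ (cong (_* f x) (δ-refl x)) (sum-zero off-x) ⟩
  1ℚ * f x + 0ℚ                                                    ≡⟨ solve 1 (λ a → con 1ℚ :* a :+ con 0ℚ := a) refl (f x) ⟩
  f x                                                              ∎
  where
  open ≡-Reasoning
  off-x : ∀ j → δ x (punchIn x j) * f (punchIn x j) ≡ 0ℚ
  off-x j = trans (cong (_* f (punchIn x j)) (δ-≢ (Finₚ.punchInᵢ≢i x j ∘ sym))) (*-zeroˡ (f (punchIn x j)))

-- Bilinear forms

Matrix : ℕ → Set
Matrix n = Fin n → Fin n → ℚ

𝟙 : Fin n → ℚ
𝟙 _ = 1ℚ

form : Matrix n → (Fin n → ℚ) → (Fin n → ℚ) → ℚ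
form M a b = sum² (λ i j → a i * M i j * b j)

quad≡form : (M : Matrix n) (y : Fin n → ℚ) → quad M y ≡ form M y y
quad≡form M y = trans (sumℚ≡sum (λ i → sumℚ (λ j → y i * M i j * y j)))
                      (sum-cong-≗ (λ i → sumℚ≡sum (λ j → y i * M i j * y j)))

form-congᵐ : {M N : Matrix n} → (∀ i j → M i j ≡ N i j) → (a b : Fin n → ℚ) → form M a b ≡ form N a b
form-congᵐ M≡N a b = sum²-cong (λ i j → cong (λ m → a i * m * b j) (M≡N i j))

form-congᵛ : (M : Matrix n) {a a′ : Fin n → ℚ} → (∀ i → a i ≡ a′ i) → form M a a ≡ form M a′ a′
form-congᵛ M a≡a′ = sum²-cong (λ i j → cong₂ (λ x y → x * M i j * y) (a≡a′ i) (a≡a′ j))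

form-+ᵐ : (M N : Matrix n) (a b : Fin n → ℚ) → form (λ i j → M i j + N i j) a b ≡ form M a b + form N a b
form-+ᵐ M N a b = trans (sum²-cong (λ i j → solve 4 (λ x m k y → x :* (m :+ k) :* y := x :* m :* y :+ x :* k :* y) refl
                                                 (a i) (M i j) (N i j) (b j)))
                        (sum²-distrib-+ (λ i j → a i * M i j * b j) (λ i j → a i * N i j * b j))

form-*ᵐ : (c : ℚ) (M : Matrix n) (a b : Fin n → ℚ) → form (λ i j → c * M i j) a b ≡ c * form M a b
form-*ᵐ c M a b = trans (sum²-cong (λ i j → solve 4 (λ x k m y → x :* (k :* m) :* y := k :* (x :* m :* y)) refl
                                              (a i) c (M i j) (b j)))
                        (sum²-*ˡ c (λ i j → a i * M i j * b j))

form-mono-≤ : {M N : Matrix n} {a b : Fin n → ℚ} → (∀ i j → M i j ≤ N i j) → NonNeg a → NonNeg b →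
              form M a b ≤ form N a b
form-mono-≤ {a = a} {b} M≤N 0≤a 0≤b = sum²-mono-≤ (λ i j →
  *-monoʳ-≤-nonNeg (b j) {{nonNegative (0≤b j)}} (*-monoˡ-≤-nonNeg′ (0≤a i) (M≤N i j)))

form-nonNeg : {M : Matrix n} {a b : Fin n → ℚ} → (∀ i j → 0ℚ ≤ M i j) → NonNeg a → NonNeg b → 0ℚ ≤ form M a b
form-nonNeg 0≤M 0≤a 0≤b = sum-nonNeg (λ i → sum-nonNeg (λ j → *-nonNeg (*-nonNeg (0≤a i) (0≤M i j)) (0≤b j)))

form-𝟙 : (K : Matrix n) → form K 𝟙 𝟙 ≡ sum² K
form-𝟙 K = sum²-cong (λ i j → trans (*-identityʳ _) (*-identityˡ (K i j)))

sum-𝟙 : (n : ℕ) → sum (𝟙 {n}) ≡ fromℕ n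
sum-𝟙 n = sum-replicate n

form-ones : (a : Fin n → ℚ) → form (λ _ _ → 1ℚ) a a ≡ sum a * sum a
form-ones a = sym (begin
  sum a * sum a                       ≡⟨ *-distribʳ-sum (sum a) a ⟩
  sum (λ i → a i * sum a)             ≡⟨ sum-cong-≗ (λ i → *-distribˡ-sum (a i) a) ⟩
  sum² (λ i j → a i * a j)            ≡⟨ sum²-cong (λ i j → cong (_* a j) (sym (*-identityʳ (a i)))) ⟩
  form (λ _ _ → 1ℚ) a a               ∎)
  where open ≡-Reasoning

form-transpose : (M : Matrix n) (a : Fin n → ℚ) → form (λ i j → M j i) a a ≡ form M a a
form-transpose M a =
  trans (∑-comm (λ i j → a i * M j i * a j))
        (sum²-cong (λ j i → solve 3 (λ x m y → x :* m :* y := y :* m :* x) refl (a i) (M j i) (a j)))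

form-scale : (M : Matrix n) (c : ℚ) (a : Fin n → ℚ) → form M (λ j → c * a j) (λ j → c * a j) ≡ c * c * form M a a
form-scale M c a = trans (sum²-cong (λ i j → solve 4 (λ k x m y → k :* x :* m :* (k :* y) := k :* k :* (x :* m :* y)) refl
                                               c (a i) (M i j) (a j)))
                         (sum²-*ˡ (c * c) (λ i j → a i * M i j * a j))

form-polarize : (M : Matrix n) (a b : Fin n → ℚ) (t : ℚ) →
                form M (λ j → a j + t * b j) (λ j → a j + t * b j)
                  ≡ form M a a + t * (form M a b + form M b a) + t * t * form M b b
form-polarize M a b t = begin
  form M (λ j → a j + t * b j) (λ j → a j + t * b j)
    ≡⟨ sum²-cong (λ i j → solve 6 (λ x m y u v k →
          (x :+ k :* u) :* m :* (y :+ k :* v) := x :* m :* y :+ k :* (x :* m :* v :+ u :* m :* y) :+ k :* k :* (u :* m :* v))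
          refl (a i) (M i j) (a j) (b i) (b j) t) ⟩
  sum² (λ i j → P i j + t * Q i j + t * t * R i j)
    ≡⟨ trans (sum²-distrib-+ (λ i j → P i j + t * Q i j) (λ i j → t * t * R i j))
             (cong₂ _+_ (trans (sum²-distrib-+ P (λ i j → t * Q i j)) (cong (sum² P +_) (sum²-*ˡ t Q)))
                        (sum²-*ˡ (t * t) R)) ⟩
  form M a a + t * sum² Q + t * t * form M b b
    ≡⟨ cong (λ s → form M a a + t * s + t * t * form M b b)
             (sum²-distrib-+ (λ i j → a i * M i j * b j) (λ i j → b i * M i j * a j)) ⟩
  form M a a + t * (form M a b + form M b a) + t * t * form M b b ∎
  where
  open ≡-Reasoning
  P Q R : Fin _ → Fin _ → ℚ
  P i j = a i * M i j * a j
  Q i j = a i * M i j * b j + b i * M i j * a j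
  R i j = b i * M i j * b j

form-remove-zero : (K : Matrix (suc n)) (w : Fin (suc n) → ℚ) (x : Fin (suc n)) → w x ≡ 0ℚ →
                   form K w w ≡ form (λ i j → K (punchIn x i) (punchIn x j)) (w ∘ punchIn x) (w ∘ punchIn x)
form-remove-zero K w x wx≡0 =
  trans (sum-remove-zero (λ i → sum (λ j → w i * K i j * w j)) x (sum-zero row-x))
        (sum-cong-≗ (λ i → sum-remove-zero (λ j → w (punchIn x i) * K (punchIn x i) j * w j) x (column-x i)))
  where
  row-x : ∀ j → w x * K x j * w j ≡ 0ℚ
  row-x j = trans (cong (λ s → s * K x j * w j) wx≡0) (trans (cong (_* w j) (*-zeroˡ (K x j))) (*-zeroˡ (w j)))
  column-x : ∀ i → w (punchIn x i) * K (punchIn x i) x * w x ≡ 0ℚ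
  column-x i = trans (cong (w (punchIn x i) * K (punchIn x i) x *_) wx≡0) (*-zeroʳ (w (punchIn x i) * K (punchIn x i) x))

push : (Fin m → Fin n) → (Fin m → ℚ) → Fin n → ℚ
push φ z k = sum (λ i → z i * δ (φ i) k)

push-nonNeg : (φ : Fin m → Fin n) {z : Fin m → ℚ} → NonNeg z → NonNeg (push φ z)
push-nonNeg φ 0≤z k = sum-nonNeg (λ i → *-nonNeg (0≤z i) (δ-nonNeg (φ i) k))

sum-push : (φ : Fin m → Fin n) (z : Fin m → ℚ) (h : Fin n → ℚ) →
           sum (λ k → push φ z k * h k) ≡ sum (λ i → z i * h (φ i))
sum-push φ z h = begin
  sum (λ k → push φ z k * h k)                  ≡⟨ sum-cong-≗ (λ k → *-distribʳ-sum (h k) (λ i → z i * δ (φ i) k)) ⟩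
  sum (λ k → sum (λ i → z i * δ (φ i) k * h k))  ≡⟨ ∑-comm (λ k i → z i * δ (φ i) k * h k) ⟩
  sum (λ i → sum (λ k → z i * δ (φ i) k * h k))  ≡⟨ sum-cong-≗ (λ i → trans (sum-cong-≗ (λ k → *-assoc (z i) _ (h k)))
                                                                           (sym (*-distribˡ-sum (z i) (λ k → δ (φ i) k * h k)))) ⟩
  sum (λ i → z i * sum (λ k → δ (φ i) k * h k))  ≡⟨ sum-cong-≗ (λ i → cong (z i *_) (sum-δ (φ i) h)) ⟩
  sum (λ i → z i * h (φ i))                      ∎
  where open ≡-Reasoning

form-push : (K : Matrix n) (φ : Fin m → Fin n) (z : Fin m → ℚ) →
            form K (push φ z) (push φ z) ≡ sum² (λ i j → z i * K (φ i) (φ j) * z j)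
form-push K φ z = begin
  form K y y
    ≡⟨ sum-cong-≗ (λ k → trans (sum-cong-≗ (λ l → *-assoc (y k) (K k l) (y l)))
                               (sym (*-distribˡ-sum (y k) (λ l → K k l * y l)))) ⟩
  sum (λ k → y k * sum (λ l → K k l * y l))
    ≡⟨ sum-push φ z (λ k → sum (λ l → K k l * y l)) ⟩
  sum (λ i → z i * sum (λ l → K (φ i) l * y l))
    ≡⟨ sum-cong-≗ (λ i → cong (z i *_) (trans (sum-cong-≗ (λ l → *-comm (K (φ i) l) (y l))) (sum-push φ z (K (φ i))))) ⟩
  sum (λ i → z i * sum (λ j → z j * K (φ i) (φ j)))
    ≡⟨ sum-cong-≗ (λ i → trans (*-distribˡ-sum (z i) (λ j → z j * K (φ i) (φ j)))
                               (sum-cong-≗ (λ j → solve 3 (λ a b k → a :* (b :* k) := a :* k :* b) refl (z i) (z j) (K (φ i) (φ j))))) ⟩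
  sum² (λ i j → z i * K (φ i) (φ j) * z j) ∎
  where
  open ≡-Reasoning
  y : Fin _ → ℚ
  y = push φ z

OnPair : Fin n → Fin n → Fin n → Set
OnPair u v i = i ≡ u ⊎ i ≡ v

module _ {n} {u v : Fin n} (u≢v : u ≢ v) where

  direction : Fin n → ℚ
  direction j = δ u j - δ v j

  transfer : (Fin n → ℚ) → ℚ → Fin n → ℚ
  transfer w t j = w j + t * direction j

  transfer-at : (w : Fin n → ℚ) (t : ℚ) {j : Fin n} {a b : ℚ} → δ u j ≡ a → δ v j ≡ b →
                transfer w t j ≡ w j + t * (a - b)
  transfer-at w t δu≡a δv≡b = cong (λ s → w _ + t * s) (cong₂ _-_ δu≡a δv≡b)

  transfer-u : (w : Fin n → ℚ) (t : ℚ) → transfer w t u ≡ w u + t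
  transfer-u w t = trans (transfer-at w t (δ-refl u) (δ-≢ (u≢v ∘ sym))) (cong (w u +_) (*-identityʳ t))

  transfer-v : (w : Fin n → ℚ) (t : ℚ) → transfer w t v ≡ w v - t
  transfer-v w t = trans (transfer-at w t (δ-≢ u≢v) (δ-refl v))
                         (cong (w v +_) (trans (sym (neg-distribʳ-* t 1ℚ)) (cong -_ (*-identityʳ t))))

  transfer-other : (w : Fin n → ℚ) (t : ℚ) {j : Fin n} → j ≢ u → j ≢ v → transfer w t j ≡ w j
  transfer-other w t j≢u j≢v =
    trans (transfer-at w t (δ-≢ (j≢u ∘ sym)) (δ-≢ (j≢v ∘ sym))) (trans (cong (w _ +_) (*-zeroʳ t)) (+-identityʳ _))

  transfer-nonNeg : {w : Fin n → ℚ} {t : ℚ} → NonNeg w → 0ℚ ≤ w u + t → 0ℚ ≤ w v - t → NonNeg (transfer w t)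
  transfer-nonNeg {w} {t} 0≤w 0≤at-u 0≤at-v j = by-cases (j Finₚ.≟ u) (j Finₚ.≟ v)
    where
    by-cases : Dec (j ≡ u) → Dec (j ≡ v) → 0ℚ ≤ transfer w t j
    by-cases (yes refl) _          = subst (0ℚ ≤_) (sym (transfer-u w t)) 0≤at-u
    by-cases (no _)     (yes refl) = subst (0ℚ ≤_) (sym (transfer-v w t)) 0≤at-v
    by-cases (no j≢u)   (no j≢v)   = subst (0ℚ ≤_) (sym (transfer-other w t j≢u j≢v)) (0≤w j)

  sum-transfer : (w : Fin n → ℚ) (t : ℚ) → sum (transfer w t) ≡ sum w
  sum-transfer w t = begin
    sum (λ j → w j + t * (δ u j - δ v j))
      ≡⟨ sum-cong-≗ (λ j → cong (w j +_) (solve 3 (λ t a b → t :* (a :- b) := a :* t :+ b :* (:- t)) refl t (δ u j) (δ v j))) ⟩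
    sum (λ j → w j + (δ u j * t + δ v j * (- t)))
      ≡⟨ trans (∑-distrib-+ w _) (cong (sum w +_) (∑-distrib-+ (λ j → δ u j * t) (λ j → δ v j * (- t)))) ⟩
    sum w + (sum (λ j → δ u j * t) + sum (λ j → δ v j * (- t)))
      ≡⟨ cong (sum w +_) (trans (cong₂ _+_ (sum-δ u (const t)) (sum-δ v (const (- t)))) (+-inverseʳ t)) ⟩
    sum w + 0ℚ
      ≡⟨ +-identityʳ (sum w) ⟩
    sum w ∎
    where open ≡-Reasoning

  form-transfer : (K : Matrix n) → (∀ i j → OnPair u v i → OnPair u v j → K i j ≡ 0ℚ) → (w : Fin n → ℚ) (t : ℚ) →
                  form K (transfer w t) (transfer w t) ≡ form K w w + t * (form K w direction + form K direction w)
  form-transfer K K-zero w t = begin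
    form K (transfer w t) (transfer w t)                            ≡⟨ form-polarize K w d t ⟩
    form K w w + t * (form K w d + form K d w) + t * t * form K d d
      ≡⟨ cong (λ s → form K w w + t * (form K w d + form K d w) + t * t * s) (sum-zero (λ i → sum-zero (zero-term i))) ⟩
    form K w w + t * (form K w d + form K d w) + t * t * 0ℚ
      ≡⟨ solve 3 (λ a l t → a :+ t :* l :+ t :* t :* con 0ℚ := a :+ t :* l) refl (form K w w) (form K w d + form K d w) t ⟩
    form K w w + t * (form K w d + form K d w)                      ∎
    where
    open ≡-Reasoning
    d : Fin n → ℚ
    d = direction
    d-support : ∀ i → d i ≡ 0ℚ ⊎ OnPair u v i
    d-support i with i Finₚ.≟ u | i Finₚ.≟ v
    ... | yes i≡u | _       = inj₂ (inj₁ i≡u)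
    ... | no _    | yes i≡v = inj₂ (inj₂ i≡v)
    ... | no i≢u  | no i≢v  rewrite δ-≢ (i≢u ∘ sym) | δ-≢ (i≢v ∘ sym) = inj₁ refl
    zero-term : ∀ i j → d i * K i j * d j ≡ 0ℚ
    zero-term i j with d-support i | d-support j
    ... | inj₁ dᵢ≡0 | _         = trans (cong (λ s → s * K i j * d j) dᵢ≡0) (trans (cong (_* d j) (*-zeroˡ (K i j))) (*-zeroˡ (d j)))
    ... | inj₂ _    | inj₁ dⱼ≡0 = trans (cong (d i * K i j *_) dⱼ≡0) (*-zeroʳ (d i * K i j))
    ... | inj₂ i∈   | inj₂ j∈   = trans (cong (λ k → d i * k * d j) (K-zero i j i∈ j∈))
                                        (trans (cong (_* d j) (*-zeroʳ (d i))) (*-zeroˡ (d j)))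

-- Along transfer the form is affine in t (form-transfer): empty v into u or u into v,
-- whichever direction has nonnegative slope.
shift-weight : (K : Matrix n) {u v : Fin n} → u ≢ v → (∀ i j → OnPair u v i → OnPair u v j → K i j ≡ 0ℚ) →
               (w : Fin n → ℚ) → NonNeg w →
               ∃₂ λ x w′ → NonNeg w′ × w′ x ≡ 0ℚ × sum w′ ≡ sum w × form K w w ≤ form K w′ w′
shift-weight K {u} {v} u≢v K-zero w 0≤w = choose (0ℚ ≤? gain)
  where
  gain : ℚ
  gain = form K w (direction u≢v) + form K (direction u≢v) w
  improves : (t : ℚ) → 0ℚ ≤ t * gain → form K w w ≤ form K (transfer u≢v w t) (transfer u≢v w t)
  improves t 0≤t*gain = subst (form K w w ≤_) (sym (form-transfer u≢v K K-zero w t))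
                              (subst (_≤ form K w w + t * gain) (+-identityʳ (form K w w)) (+-monoʳ-≤ (form K w w) 0≤t*gain))
  choose : Dec (0ℚ ≤ gain) → ∃₂ λ x w′ → NonNeg w′ × w′ x ≡ 0ℚ × sum w′ ≡ sum w × form K w w ≤ form K w′ w′
  choose (yes 0≤gain) =
    v , transfer u≢v w (w v)
      , transfer-nonNeg u≢v 0≤w (+-mono-≤ (0≤w u) (0≤w v)) (≤-reflexive (sym (+-inverseʳ (w v))))
      , trans (transfer-v u≢v w (w v)) (+-inverseʳ (w v))
      , sum-transfer u≢v w (w v)
      , improves (w v) (*-nonNeg (0≤w v) 0≤gain)
  choose (no gain<0) =
    u , transfer u≢v w (- w u)
      , transfer-nonNeg u≢v 0≤w (≤-reflexive (sym (+-inverseʳ (w u))))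
          (subst (0ℚ ≤_) (solve 2 (λ a b → b :+ a := b :- (:- a)) refl (w u) (w v)) (+-mono-≤ (0≤w v) (0≤w u)))
      , trans (transfer-u u≢v w (- w u)) (+-inverseʳ (w u))
      , sum-transfer u≢v w (- w u)
      , improves (- w u) (subst (0ℚ ≤_) (solve 2 (λ a g → a :* (:- g) := (:- a) :* g) refl (w u) gain)
                                (*-nonNeg (0≤w u) (neg-antimono-≤ (<⇒≤ (≰⇒> gain<0)))))

Lagrangian≤1 : Matrix n → Set
Lagrangian≤1 K = ∀ y → NonNeg y → form K y y ≤ sum y * sum y

simplex⇒Lagrangian≤1 : (K : Matrix n) → (∀ y → NonNeg y → sum y ≡ 1ℚ → form K y y ≤ 1ℚ) → Lagrangian≤1 K
simplex⇒Lagrangian≤1 K bound y 0≤y with <-cmp 0ℚ (sum y)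
... | tri≈ _ 0≡Σy _ = ≤-reflexive (begin
  form K y y                                ≡⟨ form-congᵛ K (λ i → trans (y≡0 i) (sym (*-zeroˡ (y i)))) ⟩
  form K (λ j → 0ℚ * y j) (λ j → 0ℚ * y j)  ≡⟨ form-scale K 0ℚ y ⟩
  0ℚ * 0ℚ * form K y y                      ≡⟨ *-zeroˡ (form K y y) ⟩
  0ℚ                                        ≡⟨ cong (λ s → s * s) 0≡Σy ⟩
  sum y * sum y                             ∎)
  where
  open ≡-Reasoning
  y≡0 : ∀ i → y i ≡ 0ℚ
  y≡0 = sum-nonNeg-≡0 0≤y (sym 0≡Σy)
... | tri> _ _ Σy<0 = ⊥-elim (<-irrefl refl (<-≤-trans Σy<0 (sum-nonNeg 0≤y)))
... | tri< 0<Σy _ _ = begin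
  form K y y                      ≡⟨ sym (*-identityˡ (form K y y)) ⟩
  1ℚ * 1ℚ * form K y y            ≡⟨ cong (λ t → t * t * form K y y) (sym (*-inverseʳ s)) ⟩
  (s * c) * (s * c) * form K y y  ≡⟨ solve 3 (λ s c f → (s :* c) :* (s :* c) :* f := s :* s :* (c :* c :* f)) refl s c (form K y y) ⟩
  s * s * (c * c * form K y y)    ≡⟨ cong (s * s *_) (sym (form-scale K c y)) ⟩
  s * s * form K z z              ≤⟨ *-monoˡ-≤-nonNeg′ (*-nonNeg (<⇒≤ 0<Σy) (<⇒≤ 0<Σy)) (bound z 0≤z Σz≡1) ⟩
  s * s * 1ℚ                      ≡⟨ *-identityʳ (s * s) ⟩
  s * s                           ∎
  where
  open ≤-Reasoning
  s : ℚ
  s = sum y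
  instance
    s-pos : Positive s
    s-pos = positive 0<Σy
    s-nonZero : NonZero s
    s-nonZero = pos⇒nonZero s
  c : ℚ
  c = 1/ s
  z : Fin _ → ℚ
  z j = c * y j
  0≤z : NonNeg z
  0≤z j = *-nonNeg (<⇒≤ (positive⁻¹ c {{1/pos⇒pos s}})) (0≤y j)
  Σz≡1 : sum z ≡ 1ℚ
  Σz≡1 = trans (sym (*-distribˡ-sum c y)) (*-inverseˡ s)

Adjacent : MixedGraph n → Fin n → Fin n → Set
Adjacent G u v = T (Und G u v ∨ Dir G u v ∨ Dir G v u)

Complete : MixedGraph n → Set
Complete G = ∀ u v → u ≢ v → Adjacent G u v

module _ (G : MixedGraph n) {u v : Fin n} where

  adjacent⁻ : Adjacent G u v → T (Und G u v) ⊎ T (Dir G u v) ⊎ T (Dir G v u)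
  adjacent⁻ adj = Sum.map₂ (Equivalence.to T-∨) (Equivalence.to T-∨ adj)

  adjacent⁺ : T (Und G u v) ⊎ T (Dir G u v) ⊎ T (Dir G v u) → Adjacent G u v
  adjacent⁺ edge = Equivalence.from T-∨ (Sum.map₂ (Equivalence.from T-∨) edge)

adjacent-irrefl : (G : MixedGraph n) (u : Fin n) → ¬ Adjacent G u u
adjacent-irrefl G u adj rewrite und-irr G u | dir-irr G u = adj

nonadjacent-or-complete : (G : MixedGraph n) → (∃₂ λ u v → u ≢ v × ¬ Adjacent G u v) ⊎ Complete G
nonadjacent-or-complete G
  with Finₚ.any? (λ u → Finₚ.any? (λ v → ¬? (u Finₚ.≟ v) ×-dec ¬? (T? (Und G u v ∨ Dir G u v ∨ Dir G v u))))
... | yes (u , v , nonadjacent) = inj₁ (u , v , nonadjacent)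
... | no none = inj₂ (λ u v u≢v → decidable-stable (T? _) (λ ¬adj → none (u , v , u≢v , ¬adj)))

induced : MixedGraph n → (Fin m → Fin n) → MixedGraph m
induced G e = record
  { Und      = λ i j → Und G (e i) (e j)
  ; Dir      = λ i j → Dir G (e i) (e j)
  ; und-irr  = λ i → und-irr G (e i)
  ; und-sym  = λ i j → und-sym G (e i) (e j)
  ; dir-irr  = λ i → dir-irr G (e i)
  ; dir-asym = λ i j → dir-asym G (e i) (e j)
  ; disjoint = λ i j → disjoint G (e i) (e j)
  }

⊆-adjacent : {F : MixedGraph m} {G : MixedGraph n} (F⊆G : F ⊆ G) {u v : Fin m} →
             Adjacent F u v → Adjacent G (_⊆_.φ F⊆G u) (_⊆_.φ F⊆G v)
⊆-adjacent {F = F} {G} F⊆G {u} {v} adj =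
  [ φ-und u v , (λ dir → adjacent⁺ G (inj₂ (Sum.map (φ-dir u v) (φ-dir v u) dir))) ]′ (adjacent⁻ F adj)
  where open _⊆_ F⊆G

⊆-refl : (G : MixedGraph n) → G ⊆ G
⊆-refl G = record
  { φ = Function.id ; φ-inj = Function.id ; φ-und = λ u v und → adjacent⁺ G (inj₁ und) ; φ-dir = λ u v dir → dir }

⊆-trans : {F : MixedGraph m} {G : MixedGraph n} {H : MixedGraph r} → F ⊆ G → G ⊆ H → F ⊆ H
⊆-trans F⊆G G⊆H = record
  { φ     = G.φ ∘ F.φ
  ; φ-inj = F.φ-inj ∘ G.φ-inj
  ; φ-und = λ u v und → ⊆-adjacent G⊆H (F.φ-und u v und)
  ; φ-dir = λ u v dir → G.φ-dir _ _ (F.φ-dir u v dir)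
  }
  where
  module F = _⊆_ F⊆G
  module G = _⊆_ G⊆H

⊆-respˡ : {F F′ : MixedGraph m} {G : MixedGraph n} →
          (∀ i j → Und F′ i j ≡ Und F i j) → (∀ i j → Dir F′ i j ≡ Dir F i j) → F ⊆ G → F′ ⊆ G
⊆-respˡ und≡ dir≡ F⊆G = record
  { φ     = φ
  ; φ-inj = φ-inj
  ; φ-und = λ u v und → φ-und u v (subst T (und≡ u v) und)
  ; φ-dir = λ u v dir → φ-dir u v (subst T (dir≡ u v) dir)
  }
  where open _⊆_ F⊆G

induced-⊆ : (G : MixedGraph n) {e : Fin m → Fin n} → Injective _≡_ _≡_ e → induced G e ⊆ G
induced-⊆ G {e} e-inj = record { φ = e ; φ-inj = e-inj ; φ-und = λ u v und → adjacent⁺ G (inj₁ und) ; φ-dir = λ u v dir → dir }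

induced-complete : (G : MixedGraph n) {e : Fin m → Fin n} → Injective _≡_ _≡_ e → Complete G → Complete (induced G e)
induced-complete G e-inj G-complete u v u≢v = G-complete _ _ (u≢v ∘ e-inj)

Free-⊆ : {𝓕 : List Graph} {G′ : MixedGraph m} {G : MixedGraph n} → G′ ⊆ G → Free 𝓕 G → Free 𝓕 G′
Free-⊆ G′⊆G = All.map (λ F⊈G F⊆G′ → F⊈G (⊆-trans F⊆G′ G′⊆G))

allVecs : {A : Set} → List A → (n : ℕ) → List (Vec A n)
allVecs xs zero    = Vec.[] ∷ []
allVecs xs (suc n) = cartesianProductWith Vec._∷_ xs (allVecs xs n)

∈-allVecs : {A : Set} {xs : List A} → (∀ a → a ∈ xs) → (v : Vec A n) → v ∈ allVecs xs n
∈-allVecs all∈ Vec.[]       = here refl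
∈-allVecs all∈ (a Vec.∷ v) = ∈-cartesianProductWith⁺ Vec._∷_ (all∈ a) (∈-allVecs all∈ v)

IsEmbedding : MixedGraph m → MixedGraph n → (Fin m → Fin n) → Set
IsEmbedding F G φ = (∀ i j → φ i ≡ φ j → i ≡ j)
                  × (∀ i j → T (Und F i j) → Adjacent G (φ i) (φ j))
                  × (∀ i j → T (Dir F i j) → T (Dir G (φ i) (φ j)))

isEmbedding? : (F : MixedGraph m) (G : MixedGraph n) (φ : Fin m → Fin n) → Dec (IsEmbedding F G φ)
isEmbedding? F G φ =
  Finₚ.all? (λ i → Finₚ.all? (λ j → (φ i Finₚ.≟ φ j) →-dec (i Finₚ.≟ j)))
  ×-dec Finₚ.all? (λ i → Finₚ.all? (λ j → T? (Und F i j) →-dec T? (Und G (φ i) (φ j) ∨ Dir G (φ i) (φ j) ∨ Dir G (φ j) (φ i))))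
  ×-dec Finₚ.all? (λ i → Finₚ.all? (λ j → T? (Dir F i j) →-dec T? (Dir G (φ i) (φ j))))

IsEmbedding-resp : {F : MixedGraph m} {G : MixedGraph n} {φ ψ : Fin m → Fin n} →
                   (∀ i → φ i ≡ ψ i) → IsEmbedding F G φ → IsEmbedding F G ψ
IsEmbedding-resp {G = G} φ≗ψ (inj , und , dir) =
  (λ i j ψi≡ψj → inj i j (trans (φ≗ψ i) (trans ψi≡ψj (sym (φ≗ψ j)))))
  , (λ i j e → subst₂ (Adjacent G) (φ≗ψ i) (φ≗ψ j) (und i j e))
  , (λ i j e → subst₂ (λ a b → T (Dir G a b)) (φ≗ψ i) (φ≗ψ j) (dir i j e))

_⊆?_ : (F : MixedGraph m) (G : MixedGraph n) → Dec (F ⊆ G)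
_⊆?_ {m} {n} F G with any? (isEmbedding? F G ∘ lookup) (allVecs (allFin n) m)
... | yes found = yes (let (inj , und , dir) = proj₂ (satisfied found) in
                       record { φ = lookup (proj₁ (satisfied found)) ; φ-inj = inj _ _ ; φ-und = und ; φ-dir = dir })
... | no none   = no (λ F⊆G → none (lose (∈-allVecs ∈-allFin (tabulate (φ F⊆G)))
                                          (IsEmbedding-resp {F = F} {G = G} (λ i → sym (lookup∘tabulate (φ F⊆G) i))
                                                            ((λ i j → φ-inj F⊆G) , φ-und F⊆G , φ-dir F⊆G))))
  where open _⊆_

𝐔 : MixedGraph n → Matrix n
𝐔 G u v = fromBool (Und G u v)

-- Directed entries are 2, as in D; accordingly β counts every directed edge twice.
𝐃 : MixedGraph n → Matrix n
𝐃 G u v = (1ℚ + 1ℚ) * fromBool (Dir G u v)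

weight : ℚ → MixedGraph n → Matrix n
weight ρ G u v = 𝐔 G u v + ρ * 𝐃 G u v

form-weight : (ρ : ℚ) (G : MixedGraph n) (a : Fin n → ℚ) → form (weight ρ G) a a ≡ form (𝐔 G) a a + ρ * form (𝐃 G) a a
form-weight ρ G a = trans (form-+ᵐ (𝐔 G) (λ u v → ρ * 𝐃 G u v) a a) (cong (form (𝐔 G) a a +_) (form-*ᵐ ρ (𝐃 G) a a))

0≤2 : 0ℚ ≤ 1ℚ + 1ℚ
0≤2 = nonNegative⁻¹ (1ℚ + 1ℚ)

𝐃-nonNeg : (G : MixedGraph n) (u v : Fin n) → 0ℚ ≤ 𝐃 G u v
𝐃-nonNeg G u v = *-nonNeg 0≤2 (fromBool-nonNeg (Dir G u v))

⊆-𝐃 : {G : MixedGraph m} {H : MixedGraph n} (G⊆H : G ⊆ H) (i j : Fin m) → 𝐃 G i j ≤ 𝐃 H (_⊆_.φ G⊆H i) (_⊆_.φ G⊆H j)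
⊆-𝐃 G⊆H i j = *-monoˡ-≤-nonNeg′ 0≤2 (fromBool-mono (_⊆_.φ-dir G⊆H i j))

weight-no-edge : (ρ : ℚ) (G : MixedGraph n) {i j : Fin n} → Und G i j ≡ false → Dir G i j ≡ false → weight ρ G i j ≡ 0ℚ
weight-no-edge ρ G und dir =
  trans (cong₂ (λ a b → fromBool a + ρ * ((1ℚ + 1ℚ) * fromBool b)) und dir) (trans (+-identityˡ _) (*-zeroʳ ρ))

weight-nonadjacent : (ρ : ℚ) (G : MixedGraph n) {u v : Fin n} → ¬ Adjacent G u v →
                     ∀ i j → OnPair u v i → OnPair u v j → weight ρ G i j ≡ 0ℚ
weight-nonadjacent ρ G {u} {v} ¬adj i j (inj₁ refl) (inj₁ refl) = weight-no-edge ρ G (und-irr G u) (dir-irr G u)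
weight-nonadjacent ρ G {u} {v} ¬adj i j (inj₂ refl) (inj₂ refl) = weight-no-edge ρ G (und-irr G v) (dir-irr G v)
weight-nonadjacent ρ G {u} {v} ¬adj i j (inj₁ refl) (inj₂ refl) = weight-no-edge ρ G no-und no-dir
  where
  no-und : Und G u v ≡ false
  no-und = ¬T⇒≡false (¬adj ∘ adjacent⁺ G ∘ inj₁)
  no-dir : Dir G u v ≡ false
  no-dir = ¬T⇒≡false (¬adj ∘ adjacent⁺ G ∘ inj₂ ∘ inj₁)
weight-nonadjacent ρ G {u} {v} ¬adj i j (inj₂ refl) (inj₁ refl) = weight-no-edge ρ G no-und no-dir
  where
  no-und : Und G v u ≡ false
  no-und = trans (und-sym G v u) (¬T⇒≡false (¬adj ∘ adjacent⁺ G ∘ inj₁))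
  no-dir : Dir G v u ≡ false
  no-dir = ¬T⇒≡false (¬adj ∘ adjacent⁺ G ∘ inj₂ ∘ inj₂)

complete-entry : (G : MixedGraph n) → Complete G → (u v : Fin n) →
                 δ u v + (𝐔 G u v + (fromBool (Dir G u v) + fromBool (Dir G v u))) ≡ 1ℚ
complete-entry G G-complete u v with u Finₚ.≟ v
... | yes refl rewrite und-irr G u | dir-irr G u = refl
... | no u≢v =
  trans (+-identityˡ _)
        (one-of-three (Und G u v) (Dir G u v) (Dir G v u) (G-complete u v u≢v)
          (disjoint G u v) (λ und → disjoint G v u (trans (und-sym G v u) und)) (dir-asym G u v))

complete-form : (G : MixedGraph n) → Complete G → (a : Fin n → ℚ) →
                sum a * sum a ≡ form δ a a + (form (𝐔 G) a a + form (𝐃 G) a a)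
complete-form G G-complete a = begin
  sum a * sum a
    ≡⟨ sym (form-ones a) ⟩
  form (λ _ _ → 1ℚ) a a
    ≡⟨ form-congᵐ (λ u v → sym (complete-entry G G-complete u v)) a a ⟩
  form (λ u v → δ u v + (𝐔 G u v + (D₁ u v + D₁ v u))) a a
    ≡⟨ form-+ᵐ δ _ a a ⟩
  form δ a a + form (λ u v → 𝐔 G u v + (D₁ u v + D₁ v u)) a a
    ≡⟨ cong (form δ a a +_) (trans (form-+ᵐ (𝐔 G) _ a a) (cong (form (𝐔 G) a a +_) (form-+ᵐ D₁ (λ u v → D₁ v u) a a))) ⟩
  form δ a a + (form (𝐔 G) a a + (form D₁ a a + form (λ u v → D₁ v u) a a))
    ≡⟨ cong (λ t → form δ a a + (form (𝐔 G) a a + (form D₁ a a + t))) (form-transpose D₁ a) ⟩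
  form δ a a + (form (𝐔 G) a a + (form D₁ a a + form D₁ a a))
    ≡⟨ cong (λ t → form δ a a + (form (𝐔 G) a a + t)) (trans (solve 1 (λ d → d :+ d := (con 1ℚ :+ con 1ℚ) :* d) refl (form D₁ a a))
                                                               (sym (form-*ᵐ (1ℚ + 1ℚ) D₁ a a))) ⟩
  form δ a a + (form (𝐔 G) a a + form (𝐃 G) a a) ∎
  where
  open ≡-Reasoning
  D₁ : Matrix _
  D₁ u v = fromBool (Dir G u v)

complete-Lagrangian≤1 : (G : MixedGraph n) → Complete G → (ρ : ℚ) →
  Lagrangian≤1 (weight ρ G) ⇔ (∀ y → NonNeg y → (ρ - 1ℚ) * form (𝐃 G) y y ≤ form δ y y)
complete-Lagrangian≤1 G G-complete ρ = mk⇔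
  (λ bound y 0≤y → Equivalence.to (arithmetic y)
                     (subst₂ _≤_ (form-weight ρ G y) (complete-form G G-complete y) (bound y 0≤y)))
  (λ diag y 0≤y → subst₂ _≤_ (sym (form-weight ρ G y)) (sym (complete-form G G-complete y))
                    (Equivalence.from (arithmetic y) (diag y 0≤y)))
  where
  arithmetic : ∀ y → (form (𝐔 G) y y + ρ * form (𝐃 G) y y ≤ form δ y y + (form (𝐔 G) y y + form (𝐃 G) y y))
                     ⇔ ((ρ - 1ℚ) * form (𝐃 G) y y ≤ form δ y y)
  arithmetic y = weighted≤⇔ (form (𝐔 G) y y) (form (𝐃 G) y y) (form δ y y) ρ

⊆-Lagrangian≤1 : {G : MixedGraph m} {H : MixedGraph n} → Complete G → Complete H → G ⊆ H → (ρ : ℚ) →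
                 Lagrangian≤1 (weight ρ H) → Lagrangian≤1 (weight ρ G)
⊆-Lagrangian≤1 {G = G} {H} G-complete H-complete G⊆H ρ H-bound =
  Equivalence.from (complete-Lagrangian≤1 G G-complete ρ) G-diag
  where
  open _⊆_ G⊆H
  H-diag : ∀ z → NonNeg z → (ρ - 1ℚ) * form (𝐃 H) z z ≤ form δ z z
  H-diag = Equivalence.to (complete-Lagrangian≤1 H H-complete ρ) H-bound
  G-diag : ∀ y → NonNeg y → (ρ - 1ℚ) * form (𝐃 G) y y ≤ form δ y y
  G-diag y 0≤y with ≤-total (ρ - 1ℚ) 0ℚ
  ... | inj₁ ρ-1≤0 = ≤-trans (*-nonPos-nonNeg ρ-1≤0 (form-nonNeg (𝐃-nonNeg G) 0≤y 0≤y)) (form-nonNeg δ-nonNeg 0≤y 0≤y)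
  ... | inj₂ 0≤ρ-1 = begin
    (ρ - 1ℚ) * form (𝐃 G) y y                             ≤⟨ *-monoˡ-≤-nonNeg′ 0≤ρ-1 (form-mono-≤ (⊆-𝐃 G⊆H) 0≤y 0≤y) ⟩
    (ρ - 1ℚ) * sum² (λ i j → y i * 𝐃 H (φ i) (φ j) * y j)  ≡⟨ cong ((ρ - 1ℚ) *_) (sym (form-push (𝐃 H) φ y)) ⟩
    (ρ - 1ℚ) * form (𝐃 H) (push φ y) (push φ y)           ≤⟨ H-diag (push φ y) (push-nonNeg φ 0≤y) ⟩
    form δ (push φ y) (push φ y)                           ≡⟨ form-push δ φ y ⟩
    sum² (λ i j → y i * δ (φ i) (φ j) * y j)               ≡⟨ form-congᵐ (δ-injective φ-inj) y y ⟩
    form δ y y                                             ∎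
    where open ≤-Reasoning

-- The forbidden family

-- Complete mixed graphs are enumerated through their directed edges: fromCode normalises an
-- arbitrary Boolean matrix into a complete mixed graph.
Code : ℕ → Set
Code m = Vec (Vec Bool m) m

codeDir : Code m → Fin m → Fin m → Bool
codeDir c i j = lookup (lookup c i) j ∧ not (lookup (lookup c j) i)

codeUnd : Code m → Fin m → Fin m → Bool
codeUnd c i j = not (does (i Finₚ.≟ j)) ∧ not (codeDir c i j ∨ codeDir c j i)

fromCode : Code m → MixedGraph m
fromCode c = record
  { Und      = codeUnd c
  ; Dir      = codeDir c
  ; und-irr  = λ i → cong (λ b → not b ∧ not (codeDir c i i ∨ codeDir c i i)) (dec-true (i Finₚ.≟ i) refl)
  ; und-sym  = λ i j → cong₂ (λ e b → not e ∧ not b) (does-sym i j) (∨-comm (codeDir c i j) (codeDir c j i))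
  ; dir-irr  = λ i → ∧-inverseʳ (lookup (lookup c i) i)
  ; dir-asym = λ i j → ∧-not-asym (lookup (lookup c i) j) (lookup (lookup c j) i)
  ; disjoint = λ i j → ∧-not-∨ (not (does (i Finₚ.≟ j))) (codeDir c i j) (codeDir c j i)
  }

fromCode-complete : (c : Code m) → Complete (fromCode c)
fromCode-complete c u v u≢v rewrite dec-false (u Finₚ.≟ v) u≢v =
  subst T (sym (∨-inverseˡ (codeDir c u v ∨ codeDir c v u))) tt

codeOf : MixedGraph m → Code m
codeOf F = tabulate (λ i → tabulate (Dir F i))

codeOf-Dir : (F : MixedGraph m) (i j : Fin m) → codeDir (codeOf F) i j ≡ Dir F i j
codeOf-Dir F i j = trans (cong₂ (λ a b → a ∧ not b) (entry i j) (entry j i)) (∧-not-of-asym (Dir F i j) (Dir F j i) (dir-asym F i j))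
  where
  entry : ∀ i j → lookup (lookup (codeOf F) i) j ≡ Dir F i j
  entry i j = trans (cong (λ row → lookup row j) (lookup∘tabulate (λ i → tabulate (Dir F i)) i)) (lookup∘tabulate (Dir F i) j)

codeOf-Und : (F : MixedGraph m) → Complete F → (i j : Fin m) → codeUnd (codeOf F) i j ≡ Und F i j
codeOf-Und F F-complete i j with i Finₚ.≟ j
... | yes refl = sym (und-irr F i)
... | no i≢j   = trans (cong₂ (λ a b → not (a ∨ b)) (codeOf-Dir F i j) (codeOf-Dir F j i))
                       (not-∨-of-one-of-three (Und F i j) (Dir F i j) (Dir F j i) (F-complete i j i≢j)
                         (disjoint F i j) (λ und → disjoint F j i (trans (und-sym F j i) und)))

completeGraphs : ℕ → List Graph
completeGraphs zero    = []
completeGraphs (suc k) = map (λ c → k , fromCode c) (allVecs (allVecs (true ∷ false ∷ []) k) k) ++ completeGraphs k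

∈-completeGraphs : {k : ℕ} → m ℕ.< k → (c : Code m) → (m , fromCode c) ∈ completeGraphs k
∈-completeGraphs {m} {suc k} m<1+k c with m ℕ.≟ k
... | yes refl = ∈-++⁺ˡ (∈-map⁺ (λ c → m , fromCode c) (∈-allVecs (∈-allVecs bool∈) c))
  where
  bool∈ : ∀ b → b ∈ true ∷ false ∷ []
  bool∈ true  = here refl
  bool∈ false = there (here refl)
... | no m≢k   = ∈-++⁺ʳ _ (∈-completeGraphs (ℕₚ.≤∧≢⇒< (ℕₚ.≤-pred m<1+k) m≢k) c)

completeGraphs-complete : (k : ℕ) → All.All (λ F → Complete (proj₂ F)) (completeGraphs k)
completeGraphs-complete zero    = All.[]
completeGraphs-complete (suc k) = Allₚ.++⁺ (Allₚ.map⁺ (All.universal fromCode-complete _)) (completeGraphs-complete k)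

⊈? : (H : MixedGraph r) (F : Graph) → Dec (¬ (proj₂ F ⊆ H))
⊈? H F = ¬? (proj₂ F ⊆? H)

forbidden : MixedGraph r → List Graph
forbidden {r} H = filter (⊈? H) (completeGraphs (suc (suc r)))

complete⊆induced⇒⊆ : {F : MixedGraph m} {H : MixedGraph r} {e : Fin n → Fin r} →
                     Complete F → F ⊆ induced H e → F ⊆ H
complete⊆induced⇒⊆ {F = F} {H} {e} F-complete F⊆ = record
  { φ     = e ∘ φ
  ; φ-inj = λ {i} {j} → injective i j
  ; φ-und = φ-und
  ; φ-dir = φ-dir
  }
  where
  open _⊆_ F⊆
  injective : ∀ i j → e (φ i) ≡ e (φ j) → i ≡ j
  injective i j e∘φ≡ with i Finₚ.≟ j
  ... | yes i≡j = i≡j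
  ... | no i≢j  = ⊥-elim (adjacent-irrefl H (e (φ j))
                   (subst (λ a → Adjacent H a (e (φ j))) e∘φ≡ (⊆-adjacent F⊆ (F-complete i j i≢j))))

induced-free : (H : MixedGraph r) (e : Fin n → Fin r) → Free (forbidden H) (induced H e)
induced-free {r} H e = All.tabulate (λ F∈ → lemma (∈-filter⁻ (⊈? H) F∈))
  where
  lemma : {F : Graph} → F ∈ completeGraphs (suc (suc r)) × ¬ (proj₂ F ⊆ H) → ¬ (proj₂ F ⊆ induced H e)
  lemma (F∈ , F⊈H) F⊆ = F⊈H (complete⊆induced⇒⊆ (All.lookup (completeGraphs-complete (suc (suc r))) F∈) F⊆)

free⇒small-complete⊆ : {H : MixedGraph r} {G : MixedGraph n} {F : MixedGraph m} →
                       Free (forbidden H) G → Complete F → F ⊆ G → m ℕ.< suc (suc r) → F ⊆ H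
free⇒small-complete⊆ {r} {H = H} {F = F} free F-complete F⊆G m<r+2 with fromCode (codeOf F) ⊆? H
... | yes F̂⊆H = ⊆-respˡ (λ i j → sym (codeOf-Und F F-complete i j)) (λ i j → sym (codeOf-Dir F i j)) F̂⊆H
... | no F̂⊈H  = ⊥-elim (All.lookup free (∈-filter⁺ (⊈? H) (∈-completeGraphs {k = suc (suc r)} m<r+2 (codeOf F)) F̂⊈H)
                                  (⊆-respˡ (codeOf-Und F F-complete) (codeOf-Dir F) F⊆G))

free⇒complete⊆ : {H : MixedGraph r} {G : MixedGraph n} {F : MixedGraph m} →
                 Free (forbidden H) G → Complete F → F ⊆ G → F ⊆ H
free⇒complete⊆ {r} {m = m} {H = H} {F = F} free F-complete F⊆G with m ℕ.<? suc (suc r)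
... | yes m<r+2 = free⇒small-complete⊆ free F-complete F⊆G m<r+2
... | no m≮r+2  = ⊥-elim (ℕₚ.1+n≰n (Finₚ.injective⇒≤ (_⊆_.φ-inj F′⊆H)))
  where
  r+1≤m : suc r ℕ.≤ m
  r+1≤m = ℕₚ.≤-trans (ℕₚ.n≤1+n (suc r)) (ℕₚ.≮⇒≥ m≮r+2)
  prefix : Fin (suc r) → Fin m
  prefix i = inject≤ i r+1≤m
  prefix-inj : Injective _≡_ _≡_ prefix
  prefix-inj {i} {j} = Finₚ.inject≤-injective r+1≤m r+1≤m i j
  F′⊆H : induced F prefix ⊆ H
  F′⊆H = free⇒small-complete⊆ {F = induced F prefix} free (induced-complete F prefix-inj F-complete)
                               (⊆-trans (induced-⊆ F prefix-inj) F⊆G) (ℕₚ.n<1+n (suc r))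

-- Upper bound

free⇒Lagrangian≤1 : {H : MixedGraph r} → Complete H → (ρ : ℚ) → Lagrangian≤1 (weight ρ H) →
                    (G : MixedGraph n) → Free (forbidden H) G → Lagrangian≤1 (weight ρ G)
free⇒Lagrangian≤1 H-complete ρ H-bound G free w 0≤w with nonadjacent-or-complete G
... | inj₂ G-complete =
  ⊆-Lagrangian≤1 G-complete H-complete (free⇒complete⊆ free G-complete (⊆-refl G)) ρ H-bound w 0≤w
free⇒Lagrangian≤1 {n = suc n} H-complete ρ H-bound G free w 0≤w | inj₁ (u , v , u≢v , ¬adj)
  with shift-weight (weight ρ G) u≢v (weight-nonadjacent ρ G ¬adj) w 0≤w
... | x , w′ , 0≤w′ , w′x≡0 , Σw′≡Σw , w≤w′ = begin
  form (weight ρ G) w w                                 ≤⟨ w≤w′ ⟩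
  form (weight ρ G) w′ w′                               ≡⟨ form-remove-zero (weight ρ G) w′ x w′x≡0 ⟩
  form (weight ρ (induced G (punchIn x))) (w′ ∘ punchIn x) (w′ ∘ punchIn x)
    ≤⟨ free⇒Lagrangian≤1 H-complete ρ H-bound (induced G (punchIn x))
                         (Free-⊆ (induced-⊆ G (Finₚ.punchIn-injective x _ _)) free) (w′ ∘ punchIn x) (0≤w′ ∘ punchIn x) ⟩
  sum (w′ ∘ punchIn x) * sum (w′ ∘ punchIn x)           ≡⟨ cong (λ s → s * s) (trans (sym (sum-remove-zero w′ x w′x≡0)) Σw′≡Σw) ⟩
  sum w * sum w                                         ∎
  where open ≤-Reasoning

density : ℚ → MixedGraph n → ℚ
density ρ G = α G + ρ * β G

density-identity : (ρ : ℚ) {k : ℕ} (G : MixedGraph (suc (suc k))) →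
                   density ρ G * fromℕ (suc (suc k) ℕ.* suc k) ≡ form (weight ρ G) 𝟙 𝟙
density-identity ρ {k} G = begin
  (α G + ρ * β G) * N
    ≡⟨ solve 4 (λ a b ρ n → (a :+ ρ :* b) :* n := a :* n :+ ρ :* (b :* n)) refl (α G) (β G) ρ N ⟩
  α G * N + ρ * (β G * N)
    ≡⟨ cong₂ (λ a b → a + ρ * b) (/-fromℕ (countPairs (Und G)) N-1) (/-fromℕ (2 ℕ.* countPairs (Dir G)) N-1) ⟩
  fromℕ (countPairs (Und G)) + ρ * fromℕ (2 ℕ.* countPairs (Dir G))
    ≡⟨ cong₂ (λ a b → a + ρ * b) (fromℕ-countPairs (Und G))
                                 (trans (fromℕ-* 2 (countPairs (Dir G))) (cong (fromℕ 2 *_) (fromℕ-countPairs (Dir G)))) ⟩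
  sum² (𝐔 G) + ρ * ((1ℚ + 1ℚ) * sum² (λ i j → fromBool (Dir G i j)))
    ≡⟨ cong (λ b → sum² (𝐔 G) + ρ * b) (sym (sum²-*ˡ (1ℚ + 1ℚ) (λ i j → fromBool (Dir G i j)))) ⟩
  sum² (𝐔 G) + ρ * sum² (𝐃 G)
    ≡⟨ sym (cong₂ (λ a b → a + ρ * b) (form-𝟙 (𝐔 G)) (form-𝟙 (𝐃 G))) ⟩
  form (𝐔 G) 𝟙 𝟙 + ρ * form (𝐃 G) 𝟙 𝟙
    ≡⟨ sym (form-weight ρ G 𝟙) ⟩
  form (weight ρ G) 𝟙 𝟙 ∎
  where
  open ≡-Reasoning
  N-1 : ℕ
  N-1 = k ℕ.+ suc k ℕ.* suc k
  N : ℚ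
  N = fromℕ (suc (suc k) ℕ.* suc k)

density-≤ : (ρ ε : ℚ) → 0ℚ ≤ ε → (M : ℕ) → 1ℚ ≤ ε * fromℕ M → (G : MixedGraph n) → M ℕ.< n →
            form (weight ρ G) 𝟙 𝟙 ≤ fromℕ n * fromℕ n → density ρ G ≤ 1ℚ + ε
-- α and β are 0 on fewer than two vertices.
density-≤ {zero}        ρ ε 0≤ε M 1≤εM G _ _ = ≤-trans (≤-reflexive (trans (+-identityˡ _) (*-zeroʳ ρ)))
                                                        (+-mono-≤ (nonNegative⁻¹ 1ℚ) 0≤ε)
density-≤ {suc zero}    ρ ε 0≤ε M 1≤εM G _ _ = ≤-trans (≤-reflexive (trans (+-identityˡ _) (*-zeroʳ ρ)))
                                                        (+-mono-≤ (nonNegative⁻¹ 1ℚ) 0≤ε)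
density-≤ {suc (suc k)} ρ ε 0≤ε M 1≤εM G M<n bound =
  *-cancelʳ-≤-pos (fromℕ (suc (suc k) ℕ.* suc k)) {{positive (fromℕ-suc-pos (k ℕ.+ suc k ℕ.* suc k))}} (begin
    density ρ G * fromℕ (suc (suc k) ℕ.* suc k)    ≡⟨ density-identity ρ G ⟩
    form (weight ρ G) 𝟙 𝟙                           ≤⟨ bound ⟩
    (1ℚ + Y) * (1ℚ + Y)
      ≡⟨ solve 1 (λ y → (con 1ℚ :+ y) :* (con 1ℚ :+ y) := (con 1ℚ :+ y) :* con 1ℚ :+ (con 1ℚ :+ y) :* y) refl Y ⟩
    (1ℚ + Y) * 1ℚ + (1ℚ + Y) * Y
      ≤⟨ +-monoˡ-≤ ((1ℚ + Y) * Y) (*-monoˡ-≤-nonNeg′ (fromℕ-nonNeg (suc (suc k))) 1≤εY) ⟩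
    (1ℚ + Y) * (ε * Y) + (1ℚ + Y) * Y
      ≡⟨ solve 3 (λ y e n → n :* (e :* y) :+ n :* y := (con 1ℚ :+ e) :* (n :* y)) refl Y ε (1ℚ + Y) ⟩
    (1ℚ + ε) * ((1ℚ + Y) * Y)
      ≡⟨ cong ((1ℚ + ε) *_) (sym (fromℕ-* (suc (suc k)) (suc k))) ⟩
    (1ℚ + ε) * fromℕ (suc (suc k) ℕ.* suc k)        ∎)
  where
  open ≤-Reasoning
  Y : ℚ
  Y = fromℕ (suc k)
  1≤εY : 1ℚ ≤ ε * Y
  1≤εY = ≤-trans 1≤εM (*-monoˡ-≤-nonNeg′ 0≤ε (fromℕ-mono-≤ (ℕₚ.≤-pred M<n)))

Lagrangian≤1⇒LimsupBound : {H : MixedGraph r} → Complete H → (ρ : ℚ) → Lagrangian≤1 (weight ρ H) → LimsupBound (forbidden H) ρ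
Lagrangian≤1⇒LimsupBound {H = H} H-complete ρ H-bound ε 0<ε with archimedean ε 0<ε
... | M , 1≤εM = suc M , λ n M<n G free →
  density-≤ ρ ε (<⇒≤ 0<ε) M 1≤εM G M<n
    (subst (form (weight ρ G) 𝟙 𝟙 ≤_) (cong (λ s → s * s) (sum-𝟙 n))
           (free⇒Lagrangian≤1 H-complete ρ H-bound G free 𝟙 (λ _ → nonNegative⁻¹ 1ℚ)))

-- Lower bound

part : (x : Fin r → ℕ) → Fin (sumℕ x) → Fin r
part {suc r} x v = [ const zero , suc ∘ part (λ i → x (suc i)) ]′ (splitAt (x zero) v)

sum-part : (x : Fin r → ℕ) (f : Fin r → ℚ) → sum (λ v → f (part x v)) ≡ sum (λ i → fromℕ (x i) * f i)
sum-part {zero}  x f = refl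
sum-part {suc r} x f = begin
  sum (λ v → f (part x v))
    ≡⟨ sum-↑ {x zero} {rest} (λ v → f (part x v)) ⟩
  sum (λ i → f (part x (i ↑ˡ rest))) + sum (λ j → f (part x (x zero ↑ʳ j)))
    ≡⟨ cong₂ _+_ (sum-cong-≗ (λ i → cong (f ∘ pick) (Finₚ.splitAt-↑ˡ (x zero) i rest)))
                 (sum-cong-≗ (λ j → cong (f ∘ pick) (Finₚ.splitAt-↑ʳ (x zero) rest j))) ⟩
  sum {x zero} (λ _ → f zero) + sum (λ j → f (suc (part (λ i → x (suc i)) j)))
    ≡⟨ cong₂ _+_ (trans (sum-replicate (x zero))
                        (sym (trans (×-assoc-* (x zero) 1ℚ (f zero)) (cong (x zero ·_) (*-identityˡ (f zero))))))
                 (sum-part (λ i → x (suc i)) (λ i → f (suc i))) ⟩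
  fromℕ (x zero) * f zero + sum (λ i → fromℕ (x (suc i)) * f (suc i)) ∎
  where
  open ≡-Reasoning
  rest : ℕ
  rest = sumℕ (λ i → x (suc i))
  pick : Fin (x zero) ⊎ Fin rest → Fin (suc r)
  pick = [ const zero , suc ∘ part (λ i → x (suc i)) ]′

blowUp-form : (K : Matrix r) (x : Fin r → ℕ) →
              sum² (λ u v → K (part x u) (part x v)) ≡ form K (λ i → fromℕ (x i)) (λ i → fromℕ (x i))
blowUp-form K x = begin
  sum² (λ u v → K (part x u) (part x v))
    ≡⟨ sum-cong-≗ (λ u → sum-part x (K (part x u))) ⟩
  sum (λ u → sum (λ j → fromℕ (x j) * K (part x u) j))
    ≡⟨ sum-part x (λ i → sum (λ j → fromℕ (x j) * K i j)) ⟩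
  sum (λ i → fromℕ (x i) * sum (λ j → fromℕ (x j) * K i j))
    ≡⟨ sum-cong-≗ (λ i → trans (*-distribˡ-sum (fromℕ (x i)) (λ j → fromℕ (x j) * K i j))
                                (sum-cong-≗ (λ j → solve 3 (λ a b k → a :* (b :* k) := a :* k :* b) refl (fromℕ (x i)) (fromℕ (x j)) (K i j)))) ⟩
  form K (λ i → fromℕ (x i)) (λ i → fromℕ (x i)) ∎
  where open ≡-Reasoning

density-≥ : (ρ Q : ℚ) → 0ℚ ≤ Q → (G : MixedGraph n) → 2 ℕ.≤ n →
            form (weight ρ G) 𝟙 𝟙 ≡ fromℕ n * fromℕ n * Q → Q ≤ density ρ G
density-≥ {suc zero}    ρ Q 0≤Q G (ℕ.s≤s ()) form≡
density-≥ {suc (suc k)} ρ Q 0≤Q G _ form≡ =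
  *-cancelʳ-≤-pos (fromℕ (suc (suc k) ℕ.* suc k)) {{positive (fromℕ-suc-pos (k ℕ.+ suc k ℕ.* suc k))}} (begin
    Q * fromℕ (suc (suc k) ℕ.* suc k)
      ≤⟨ *-monoˡ-≤-nonNeg′ 0≤Q (fromℕ-mono-≤ (ℕₚ.*-monoʳ-≤ (suc (suc k)) (ℕₚ.n≤1+n (suc k)))) ⟩
    Q * fromℕ (suc (suc k) ℕ.* suc (suc k))
      ≡⟨ trans (cong (Q *_) (fromℕ-* (suc (suc k)) (suc (suc k)))) (*-comm Q _) ⟩
    fromℕ (suc (suc k)) * fromℕ (suc (suc k)) * Q
      ≡⟨ sym form≡ ⟩
    form (weight ρ G) 𝟙 𝟙
      ≡⟨ sym (density-identity ρ G) ⟩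
    density ρ G * fromℕ (suc (suc k) ℕ.* suc k) ∎)
  where open ≤-Reasoning

large-blowUp : (H : MixedGraph r) (ρ : ℚ) (y : Fin r → ℚ) → NonNeg y → sum y ≡ 1ℚ → 0ℚ ≤ form (weight ρ H) y y →
               (N : ℕ) → ∃ λ x → N ℕ.≤ sumℕ x × form (weight ρ H) y y ≤ density ρ (induced H (part x))
large-blowUp H ρ y 0≤y Σy≡1 0≤Q N with common-denominator y 0≤y
... | L , a , yL≡a = x , ℕₚ.≤-trans (ℕₚ.m≤n+m N 2) N+2≤n , density-≥ ρ Q 0≤Q (induced H (part x)) 2≤n form≡
  where
  Q : ℚ
  Q = form (weight ρ H) y y
  x : Fin _ → ℕ
  x j = suc (suc N) ℕ.* a j
  c : ℚ
  c = fromℕ (suc (suc N)) * fromℕ (suc L)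
  x≡cy : ∀ j → fromℕ (x j) ≡ c * y j
  x≡cy j = trans (fromℕ-* (suc (suc N)) (a j)) (trans (cong (fromℕ (suc (suc N)) *_) (sym (yL≡a j)))
                  (solve 3 (λ n y l → n :* (y :* l) := n :* l :* y) refl (fromℕ (suc (suc N))) (y j) (fromℕ (suc L))))
  n≡c : fromℕ (sumℕ x) ≡ c
  n≡c = trans (fromℕ-sumℕ x) (trans (sum-cong-≗ x≡cy)
          (trans (sym (*-distribˡ-sum c y)) (trans (cong (c *_) Σy≡1) (*-identityʳ c))))
  N+2≤n : suc (suc N) ℕ.≤ sumℕ x
  N+2≤n = fromℕ-cancel-≤ (subst (fromℕ (suc (suc N)) ≤_) (sym n≡c) (subst (_≤ c) (*-identityʳ (fromℕ (suc (suc N))))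
            (*-monoˡ-≤-nonNeg′ (fromℕ-nonNeg (suc (suc N))) (fromℕ-mono-≤ (ℕ.s≤s (ℕ.z≤n {L}))))))
  2≤n : 2 ℕ.≤ sumℕ x
  2≤n = ℕₚ.≤-trans (ℕ.s≤s (ℕ.s≤s ℕ.z≤n)) N+2≤n
  form≡ : form (weight ρ (induced H (part x))) 𝟙 𝟙 ≡ fromℕ (sumℕ x) * fromℕ (sumℕ x) * Q
  form≡ = begin
    form (weight ρ (induced H (part x))) 𝟙 𝟙                   ≡⟨ form-𝟙 (weight ρ (induced H (part x))) ⟩
    sum² (λ u v → weight ρ H (part x u) (part x v))           ≡⟨ blowUp-form (weight ρ H) x ⟩
    form (weight ρ H) (λ i → fromℕ (x i)) (λ i → fromℕ (x i)) ≡⟨ form-congᵛ (weight ρ H) x≡cy ⟩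
    form (weight ρ H) (λ j → c * y j) (λ j → c * y j)         ≡⟨ form-scale (weight ρ H) c y ⟩
    c * c * Q                                                 ≡⟨ cong (λ t → t * t * Q) (sym n≡c) ⟩
    fromℕ (sumℕ x) * fromℕ (sumℕ x) * Q                       ∎
    where open ≡-Reasoning

LimsupBound⇒simplex : (H : MixedGraph r) (ρ : ℚ) → LimsupBound (forbidden H) ρ →
                      ∀ y → NonNeg y → sum y ≡ 1ℚ → form (weight ρ H) y y ≤ 1ℚ
LimsupBound⇒simplex H ρ limsup y 0≤y Σy≡1 with ≤-total (form (weight ρ H) y y) 0ℚ
... | inj₁ Q≤0 = ≤-trans Q≤0 (nonNegative⁻¹ 1ℚ)
... | inj₂ 0≤Q = ≤+ε⇒≤ λ ε 0<ε →
  let (N , bound) = limsup ε 0<ε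
      (x , N≤n , Q≤density) = large-blowUp H ρ y 0≤y Σy≡1 0≤Q N
  in ≤-trans Q≤density (bound (sumℕ x) N≤n (induced H (part x)) (induced-free H (part x)))

B⟦𝟏⟧ : (B : MixedAdjMatrix r) → (∀ i → U B i i ≡ false) → MixedGraph r
B⟦𝟏⟧ B U-irr = record
  { Und      = U B
  ; Dir      = D B
  ; und-irr  = U-irr
  ; und-sym  = U-sym B
  ; dir-irr  = D-irr
  ; dir-asym = D-asym B
  ; disjoint = disjoint B
  }
  where
  D-irr : ∀ i → D B i i ≡ false
  D-irr i with D B i i in Dᵢᵢ
  ... | false = refl
  ... | true  = trans (sym Dᵢᵢ) (D-asym B i i Dᵢᵢ)

U-entry≡𝐔 : (B : MixedAdjMatrix r) (i j : Fin r) → U-entry B i j ≡ fromBool (U B i j)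
U-entry≡𝐔 B i j with U B i j
... | true  = refl
... | false = refl

D-entry≡𝐃 : (B : MixedAdjMatrix r) (i j : Fin r) → D-entry B i j ≡ (1ℚ + 1ℚ) * fromBool (D B i j)
D-entry≡𝐃 B i j with D B i j
... | true  = refl
... | false = refl

simplex-condition⇔ : (B : MixedAdjMatrix r) (U-irr : ∀ i → U B i i ≡ false) (ρ : ℚ) (y : Fin r → ℚ) →
                     (ρ * quad (D-entry B) y ≤ 1ℚ - quad (U-entry B) y) ⇔ (form (weight ρ (B⟦𝟏⟧ B U-irr)) y y ≤ 1ℚ)
simplex-condition⇔ B U-irr ρ y =
  subst (λ q → (ρ * quad (D-entry B) y ≤ 1ℚ - quad (U-entry B) y) ⇔ (q ≤ 1ℚ)) weighted
        (≤-sub⇔+≤ (ρ * quad (D-entry B) y) (quad (U-entry B) y) 1ℚ)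
  where
  weighted : quad (U-entry B) y + ρ * quad (D-entry B) y ≡ form (weight ρ (B⟦𝟏⟧ B U-irr)) y y
  weighted = trans (cong₂ (λ a b → a + ρ * b) (trans (quad≡form (U-entry B) y) (form-congᵐ (U-entry≡𝐔 B) y y))
                                               (trans (quad≡form (D-entry B) y) (form-congᵐ (D-entry≡𝐃 B) y y)))
                   (sym (form-weight ρ (B⟦𝟏⟧ B U-irr) y))

lemma5p2 : (r : ℕ) (B : MixedAdjMatrix r) →
    (∃ λ i → ∃ λ j → D B i j ≡ true) →
    (∀ i → U B i i ≡ false) →
    (∀ i j → i ≢ j → T (U B i j ∨ D B i j ∨ D B j i)) →
    ∃ λ (𝓕 : List Graph) → ∀ (ρ : ℚ) →
      (LimsupBound 𝓕 ρ →
         ∀ (y : Fin r → ℚ) → InSimplex y → ρ * quad (D-entry B) y ≤ 1ℚ - quad (U-entry B) y)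
      × ((∀ (y : Fin r → ℚ) → InSimplex y → ρ * quad (D-entry B) y ≤ 1ℚ - quad (U-entry B) y) →
         LimsupBound 𝓕 ρ)
lemma5p2 r B _ U-irr B-complete = forbidden B₁ , λ ρ → lower ρ , upper ρ
  where
  B₁ : MixedGraph r
  B₁ = B⟦𝟏⟧ B U-irr
  lower : ∀ ρ → LimsupBound (forbidden B₁) ρ → ∀ y → InSimplex y → ρ * quad (D-entry B) y ≤ 1ℚ - quad (U-entry B) y
  lower ρ limsup y (0≤y , Σy≡1) =
    Equivalence.from (simplex-condition⇔ B U-irr ρ y) (LimsupBound⇒simplex B₁ ρ limsup y 0≤y (trans (sym (sumℚ≡sum y)) Σy≡1))
  upper : ∀ ρ → (∀ y → InSimplex y → ρ * quad (D-entry B) y ≤ 1ℚ - quad (U-entry B) y) → LimsupBound (forbidden B₁) ρ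
  upper ρ condition = Lagrangian≤1⇒LimsupBound B-complete ρ (simplex⇒Lagrangian≤1 (weight ρ B₁) (λ y 0≤y Σy≡1 →
    Equivalence.to (simplex-condition⇔ B U-irr ρ y) (condition y (0≤y , trans (sumℚ≡sum y) Σy≡1))))
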